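{- Let $M$ be a matroid on ground set $E$ and let $<$ be a pinned broken line shelling of $M$ whose first basis is $B$. For each non-loop element $i\in E\setminus B$ let $B_i$ be the basis whose restriction set with respect to $<$ is $\{i\}$. Let $I$ be an independent set of $M$ disjoint from $B$, and let $j\ge 0$. Then the number of bases $B'$ whose restriction set has $|I|+j$ elements and such that the set of atoms of $\mathrm{Int}_<(M)$ below $B'$ is exactly $\{B_i : i\in I\}$ equals $h_j((M/I)|_B)$. If $\mathrm{Int}_<(M)$ is ranked, then the cardinality $|I|+j$ of the restriction set may be replaced by the rank of $B'$ in $\mathrm{Int}_<(M)$.
   Context: For $\ell:E\to\mathbb{R}$ and $A\subseteq E$ write $\ell(A)=\sum_{a\in A}\ell(a)$. A broken line shelling is an ordering $B_1<\dots<B_n$ of all bases of $M$ such that for each $k$ there is $\ell_k:E\to\mathbb{R}$ (a witness) with $\ell_k(B_m)<\ell_k(B_k)$ iff $m<k$; such an order is a shelling order of $\mathcal{I}(M)$. It is pinned if witnesses can be chosen such that for every $k$ the basis of smallest $\ell_k$-weight is $B_1$. For a shelling $F_1<\dots<F_k$ of a pure simplicial complex, the restriction set $\mathcal{R}(F_j)$ is the unique subset of $F_j$ such that the faces of $\langle F_1,\dots,F_j\rangle$ not in $\langle F_1,\dots,F_{j-1}\rangle$ are exactly the subsets of $F_j$ containing $\mathcal{R}(F_j)$. $\mathrm{Int}_<(M)$ is the poset on the bases with $B'\preceq B''$ iff $\mathcal{R}(B')\subseteq\mathcal{R}(B'')$; atoms are elements covering the minimum. A loop is an element $e$ with $\{e\}$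 dependent. $(M/I)|_B$ is the matroid on ground set $B$ whose independent sets are the $J\subseteq B$ with $J\cup I$ independent in $M$. For a simplicial complex $\Delta$ of dimension $d-1$ with $f_{i}$ faces of size $i+1$, the $h$-vector $(h_0,\dots,h_d)$ is defined by $\sum_j h_jx^j=\sum_j f_{j-1}x^j(1-x)^{d-j}$; $h_j((M/I)|_B)$ denotes the $h$-vector entry of its independence complex.
   Formalization: The witnesses $\ell_k$ of the pinned broken line shelling take values in ℚ instead of ℝ. -}

module Defs where

open import Data.Nat using (ℕ; zero; suc; _+_; _∸_; _⊔_)
open import Data.Nat.Combinatorics using (_C_)
open import Data.Bool using (Bool; true; false; T; if_then_else_)
open import Data.Fin as Fin using (Fin; zero; suc)
open import Data.Fin.Subset using (Subset; _∈_; _∉_; _⊆_; _∪_; _∩_; ⁅_⁆; ∣_∣; ⊥; Empty)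
open import Data.Fin.Subset.Properties using (_⊆?_)
open import Data.Vec using ([]; _∷_)
open import Data.List using (List; []; _∷_; _++_; map; filter; length; foldr; upTo)
import Data.List.Membership.Propositional as LM
open import Data.List.Relation.Unary.Unique.Propositional using (Unique)
open import Data.Integer as ℤ using (ℤ; +_; -1ℤ)
open import Data.Rational as ℚ using (ℚ; 0ℚ)
open import Data.Product using (Σ; ∃; _×_; _,_)
open import Function.Bundles using (_⇔_)
open import Relation.Nullary using (¬_; Dec; yes; no)
open import Relation.Nullary.Decidable using (_×-dec_; ⌊_⌋)
open import Relation.Binary.PropositionalEquality using (_≡_; _≢_)

record Matroid (n : ℕ) : Set where
  field
    indep   : Subset n → Bool
    indep-∅ : T (indep ⊥)
    indep-⊆ : ∀ {A B} → A ⊆ B → T (indep B) → T (indep A)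
    indep-aug : ∀ {A B} → T (indep A) → T (indep B) → ∣ A ∣ Data.Nat.< ∣ B ∣ →
                ∃ λ x → x ∈ B × x ∉ A × T (indep (⁅ x ⁆ ∪ A))

open Matroid public

Indep : ∀ {n} → Matroid n → Subset n → Set
Indep M A = T (indep M A)

IsBasis : ∀ {n} → Matroid n → Subset n → Set
IsBasis M A = Indep M A × (∀ x → x ∉ A → ¬ Indep M (⁅ x ⁆ ∪ A))

weight : ∀ {n} → (Fin n → ℚ) → Subset n → ℚ
weight {zero}  ℓ []      = 0ℚ
weight {suc n} ℓ (b ∷ A) = (if b then ℓ zero else 0ℚ) ℚ.+ weight (λ i → ℓ (suc i)) A

-- Broken line shellings (all bases listed as B 0 < B 1 < … < B N,
-- with the chosen witnesses ℓ_k)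

record BLShelling {n} (M : Matroid n) (N : ℕ) : Set where
  field
    B        : Fin (suc N) → Subset n
    B-basis  : ∀ k → IsBasis M (B k)
    B-inj    : ∀ k m → B k ≡ B m → k ≡ m
    B-surj   : ∀ A → IsBasis M A → ∃ λ k → B k ≡ A
    wit      : Fin (suc N) → Fin n → ℚ
    wit-ok   : ∀ k m → (weight (wit k) (B m) ℚ.< weight (wit k) (B k)) ⇔ (m Fin.< k)

open BLShelling public

Pinned : ∀ {n} {M : Matroid n} {N} → BLShelling M N → Set
Pinned S = ∀ k m → m ≢ zero → weight (wit S k) (B S zero) ℚ.< weight (wit S k) (B S m)

IsRestriction : ∀ {n N} → (Fin (suc N) → Subset n) → Fin (suc N) → Subset n → Set
IsRestriction {n} F j R =
  R ⊆ F j ×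
  (∀ (G : Subset n) →
     ((∃ λ i → i Fin.≤ j × G ⊆ F i) × (∀ i → i Fin.< j → ¬ (G ⊆ F i)))
     ⇔ (R ⊆ G × G ⊆ F j))

module IntPoset {n N : ℕ} (R : Fin (suc N) → Subset n) where

  _⪯_ : Fin (suc N) → Fin (suc N) → Set
  k ⪯ m = R k ⊆ R m

  _≺_ : Fin (suc N) → Fin (suc N) → Set
  k ≺ m = k ⪯ m × k ≢ m

  IsMin : Fin (suc N) → Set
  IsMin k = ∀ m → k ⪯ m

  Covers : Fin (suc N) → Fin (suc N) → Set
  Covers x y = x ≺ y × (∀ z → x ≺ z → z ≺ y → Data.Empty.⊥)
    where import Data.Empty

  IsAtom : Fin (suc N) → Set
  IsAtom a = ∃ λ m → IsMin m × Covers m a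

  AtomsBelowAre : Fin (suc N) → Subset n → Set
  AtomsBelowAre k I = ∀ a → (IsAtom a × a ⪯ k) ⇔ (∃ λ i → i ∈ I × R a ≡ ⁅ i ⁆)

  IsRankFunction : (Fin (suc N) → ℕ) → Set
  IsRankFunction ρ = (∀ m → IsMin m → ρ m ≡ 0) × (∀ x y → Covers x y → ρ y ≡ suc (ρ x))

HasCount : ∀ {N} → (Fin N → Set) → ℤ → Set
HasCount {N} P h = Σ (List (Fin N)) λ ks →
  Unique ks × (∀ k → (k LM.∈ ks) ⇔ P k) × (+ length ks ≡ h)

-- h-vector of the independence complex of (M/I)|_B

allSubsets : ∀ n → List (Subset n)
allSubsets zero    = [] ∷ []
allSubsets (suc n) = map (true ∷_) (allSubsets n) ++ map (false ∷_) (allSubsets n)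

faces : ∀ {n} → Matroid n → (I B : Subset n) → List (Subset n)
faces {n} M I B = filter (λ J → J ⊆? B ×-dec isT (indep M (J ∪ I))) (allSubsets n)
  where
    isT : (b : Bool) → Dec (T b)
    isT true  = yes _
    isT false = no λ ()

-- fSize M I B i = f_{i-1} = number of faces with i elements
fSize : ∀ {n} → Matroid n → (I B : Subset n) → ℕ → ℕ
fSize M I B i = length (filter (λ J → ∣ J ∣ Data.Nat.≟ i) (faces M I B))

dimPlus1 : ∀ {n} → Matroid n → (I B : Subset n) → ℕ
dimPlus1 M I B = foldr (λ J r → ∣ J ∣ ⊔ r) 0 (faces M I B)

-- h_j = coefficient of x^j in Σ_i f_{i-1} x^i (1-x)^{d-i}
--     = Σ_{i=0}^{j} (-1)^{j-i} C(d-i, j-i) f_{i-1}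
hVec : ∀ {n} → Matroid n → (I B : Subset n) → ℕ → ℤ
hVec M I B j = foldr ℤ._+_ (+ 0) (map term (upTo (suc j)))
  where
    d = dimPlus1 M I B
    term : ℕ → ℤ
    term i = (-1ℤ ℤ.^ (j ∸ i)) ℤ.* (+ ((d ∸ i) C (j ∸ i))) ℤ.* (+ fSize M I B i)

-- Write F k for the k-th basis of the shelling and R k for its restriction set.  Pinnedness
-- makes every element of F k outside F₀ lie in R k: otherwise an exchange against a lighter
-- element of F₀ (lighter for the witness of k) would give a basis before F k containing
-- F k minus that element.  Consequently the atoms below F k are the bases with R a = {i},
-- i ∈ F k ─ F₀, and since every nonempty R k loses one element to become another
-- restriction set, ∣ R ∣ is the rank function of Int_<(M).  So the bases to be counted are
-- those with F k ─ F₀ = I and ∣ R k ∩ F₀ ∣ = j.  On the other side, each face J of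
-- (M/I)|F₀ has a first facet F k containing J ∪ I; this forces F k ─ F₀ = I and places J
-- in the Boolean interval [R k ∩ F₀, F k ∩ F₀] of top rank.  The h-polynomial of such an
-- interval with bottom of size a is xᵃ, so summing over k gives the count.

module Submission where

open import Defs

open import Level using (Level; 0ℓ)
open import Function using (id; _∘_; _⇔_; mk⇔; Equivalence; case_of_)
open import Function.Properties.Equivalence using () renaming (refl to ⇔-refl; sym to ⇔-sym; trans to ⇔-trans)
open import Relation.Binary.PropositionalEquality
open import Relation.Nullary using (¬_; ¬?; Dec; yes; no; does; _×-dec_)
open import Relation.Nullary.Decidable using (decidable-stable; T?)
open import Relation.Unary using (Pred; Decidable; _≐_)

open import Data.Empty using (⊥-elim)
open import Data.Bool using (true; false; if_then_else_)
open import Data.Bool.Properties using () renaming (_≟_ to _≟ᵇ_)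
open import Data.Product using (Σ; ∃; _×_; _,_; proj₁; proj₂)
open import Data.Product.Function.NonDependent.Propositional using (_×-⇔_)
open import Data.Sum using (inj₁; inj₂)

open import Data.Nat as ℕ using (ℕ; zero; suc; _+_; _∸_; _!; z≤n; s≤s)
import Data.Nat.Properties as ℕP
open import Data.Nat.Combinatorics using (_C_; nCk+nC[k+1]≡[n+1]C[k+1]; k![n∸k]!∣n!)
open import Data.Nat.Combinatorics.Specification using (nCk≡n!/k![n-k]!; k>n⇒nCk≡0)
open import Data.Nat.DivMod using (_/_; m/n*n≡m)
open import Data.Nat.Tactic.RingSolver using (solve-∀)
open import Data.Integer as ℤ using (ℤ; +_; -1ℤ)
import Data.Integer.Properties as ℤP
import Data.Integer.Tactic.RingSolver as ℤ-Solver
open import Data.Rational as ℚ using (ℚ; 0ℚ)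
import Data.Rational.Properties as ℚP
open import Algebra.Properties.Semiring.Sum ℤP.+-*-semiring
  using (sum-syntax; ∑-comm; ∑-distrib-+; sum-cong-≗; *-distribˡ-sum; sum-replicate-zero)

open import Data.Fin as Fin using (Fin; zero; suc; toℕ)
import Data.Fin.Properties as FinP
open import Data.Fin.Subset
open import Data.Fin.Subset.Properties
open import Data.Vec using ([]; _∷_; here; there)
open import Data.Vec.Properties using (≡-dec)

open import Data.List using (List; []; _∷_; _++_; map; filter; length; tabulate; allFin; foldr; applyUpTo)
open import Data.List.Properties using (filter-++; filter-≐; length-++)
open import Data.List.Membership.Propositional using () renaming (_∈_ to _∈ₗ_)
open import Data.List.Membership.Propositional.Properties using (∈-allFin; ∈-filter⁺; ∈-filter⁻; ∈-map⁺; ∈-++⁺ˡ; ∈-++⁺ʳ)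
open import Data.List.Relation.Unary.Any using (here; there)
import Data.List.Relation.Unary.All as All
open import Data.List.Relation.Unary.All.Properties using (all-filter)
open import Data.List.Relation.Unary.Unique.Propositional.Properties using (filter⁺; allFin⁺)
open import Data.List.Extrema.Nat using (argmax; argmax-all; f[xs]≤f[argmax])

private variable
  a b : Level
  X Y : Set a
  m n : ℕ
  P Q : Pred X b
  p q : Subset n
  x y : Fin n

infix 4 _≟ₛ_
_≟ₛ_ : (p q : Subset n) → Dec (p ≡ q)
_≟ₛ_ = ≡-dec _≟ᵇ_

x∈p⇒⁅x⁆⊆p : x ∈ p → ⁅ x ⁆ ⊆ p
x∈p⇒⁅x⁆⊆p {x = x} {p = p} x∈p y∈⁅x⁆ = subst (_∈ p) (sym (x∈⁅y⁆⇒x≡y x y∈⁅x⁆)) x∈p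

∪-lub : ∀ {r : Subset n} → p ⊆ r → q ⊆ r → p ∪ q ⊆ r
∪-lub {p = p} {q} p⊆r q⊆r x∈p∪q with x∈p∪q⁻ p q x∈p∪q
... | inj₁ x∈p = p⊆r x∈p
... | inj₂ x∈q = q⊆r x∈q

x∈p─q⇒x∉q : ∀ (p q : Subset n) → x ∈ p ─ q → x ∉ q
x∈p─q⇒x∉q (true  ∷ p) (false ∷ q) here      ()
x∈p─q⇒x∉q (_     ∷ p) (true  ∷ q) (there r) (there s) = x∈p─q⇒x∉q p q r s
x∈p─q⇒x∉q (_     ∷ p) (false ∷ q) (there r) (there s) = x∈p─q⇒x∉q p q r s

p⊆q⇒∣q∣≤∣p∣⇒p≡q : p ⊆ q → ∣ q ∣ ℕ.≤ ∣ p ∣ → p ≡ q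
p⊆q⇒∣q∣≤∣p∣⇒p≡q {p = []}          {[]}          _   _  = refl
p⊆q⇒∣q∣≤∣p∣⇒p≡q {p = true  ∷ p}   {false ∷ q}   p⊆q _  with p⊆q here
... | ()
p⊆q⇒∣q∣≤∣p∣⇒p≡q {p = true  ∷ p}   {true  ∷ q}   p⊆q le =
  cong (true ∷_) (p⊆q⇒∣q∣≤∣p∣⇒p≡q (drop-∷-⊆ p⊆q) (ℕP.≤-pred le))
p⊆q⇒∣q∣≤∣p∣⇒p≡q {p = false ∷ p}   {false ∷ q}   p⊆q le =
  cong (false ∷_) (p⊆q⇒∣q∣≤∣p∣⇒p≡q (drop-∷-⊆ p⊆q) le)
p⊆q⇒∣q∣≤∣p∣⇒p≡q {p = false ∷ p}   {true  ∷ q}   p⊆q le =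
  ⊥-elim (ℕP.<⇒≱ (s≤s (p⊆q⇒∣p∣≤∣q∣ (drop-∷-⊆ p⊆q))) le)

x∈p⇒0<∣p∣ : x ∈ p → 0 ℕ.< ∣ p ∣
x∈p⇒0<∣p∣ {x = x} x∈p = subst (ℕ._≤ _) (∣⁅x⁆∣≡1 x) (p⊆q⇒∣p∣≤∣q∣ (x∈p⇒⁅x⁆⊆p x∈p))

∣p∣≡0⇒p≡⊥ : ∣ p ∣ ≡ 0 → p ≡ ⊥
∣p∣≡0⇒p≡⊥ ∣p∣≡0 = Empty-unique λ (_ , x∈p) → ℕP.<⇒≢ (x∈p⇒0<∣p∣ x∈p) (sym ∣p∣≡0)

∣p∣≢0⇒nonempty : ∣ p ∣ ≢ 0 → Nonempty p
∣p∣≢0⇒nonempty {n} {p} ∣p∣≢0 = decidable-stable (nonempty? p) λ empty →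
  ∣p∣≢0 (trans (cong ∣_∣ (Empty-unique empty)) (∣⊥∣≡0 n))

∣p∣≡1⇒p≡⁅x⁆ : ∣ p ∣ ≡ 1 → ∃ λ x → p ≡ ⁅ x ⁆
∣p∣≡1⇒p≡⁅x⁆ {p = p} ∣p∣≡1 =
  let (x , x∈p) = ∣p∣≢0⇒nonempty (λ ∣p∣≡0 → ℕP.1+n≢0 (trans (sym ∣p∣≡1) ∣p∣≡0)) in
  x , sym (p⊆q⇒∣q∣≤∣p∣⇒p≡q (x∈p⇒⁅x⁆⊆p x∈p) (ℕP.≤-reflexive (trans ∣p∣≡1 (sym (∣⁅x⁆∣≡1 x)))))

p⊈q⇒∃∈p∉q : ∀ (p q : Subset n) → ¬ (p ⊆ q) → ∃ λ x → x ∈ p × x ∉ q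
p⊈q⇒∃∈p∉q p q p⊈q with FinP.any? (λ x → x ∈? p ×-dec ¬? (x ∈? q))
... | yes found = found
... | no  none  = ⊥-elim (p⊈q λ {x} x∈p → decidable-stable (x ∈? q) λ x∉q → none (x , x∈p , x∉q))

∣p∣≡∣p∩q∣+∣p─q∣ : ∀ (p q : Subset n) → ∣ p ∣ ≡ ∣ p ∩ q ∣ + ∣ p ─ q ∣
∣p∣≡∣p∩q∣+∣p─q∣ []          []          = refl
∣p∣≡∣p∩q∣+∣p─q∣ (true  ∷ p) (true  ∷ q) = cong suc (∣p∣≡∣p∩q∣+∣p─q∣ p q)
∣p∣≡∣p∩q∣+∣p─q∣ (true  ∷ p) (false ∷ q) = trans (cong suc (∣p∣≡∣p∩q∣+∣p─q∣ p q)) (sym (ℕP.+-suc _ _))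
∣p∣≡∣p∩q∣+∣p─q∣ (false ∷ p) (true  ∷ q) = ∣p∣≡∣p∩q∣+∣p─q∣ p q
∣p∣≡∣p∩q∣+∣p─q∣ (false ∷ p) (false ∷ q) = ∣p∣≡∣p∩q∣+∣p─q∣ p q

p⊆q⇒∣q∣≡∣p∣+∣q─p∣ : p ⊆ q → ∣ q ∣ ≡ ∣ p ∣ + ∣ q ─ p ∣
p⊆q⇒∣q∣≡∣p∣+∣q─p∣ {p = []}        {[]}        _   = refl
p⊆q⇒∣q∣≡∣p∣+∣q─p∣ {p = true ∷ p}  {false ∷ q} p⊆q with p⊆q here
... | ()
p⊆q⇒∣q∣≡∣p∣+∣q─p∣ {p = true ∷ p}  {true ∷ q}  p⊆q = cong suc (p⊆q⇒∣q∣≡∣p∣+∣q─p∣ (drop-∷-⊆ p⊆q))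
p⊆q⇒∣q∣≡∣p∣+∣q─p∣ {p = false ∷ p} {true ∷ q}  p⊆q =
  trans (cong suc (p⊆q⇒∣q∣≡∣p∣+∣q─p∣ (drop-∷-⊆ p⊆q))) (sym (ℕP.+-suc _ _))
p⊆q⇒∣q∣≡∣p∣+∣q─p∣ {p = false ∷ p} {false ∷ q} p⊆q = p⊆q⇒∣q∣≡∣p∣+∣q─p∣ (drop-∷-⊆ p⊆q)

∣p∪q∣≡∣p∣+∣q∣ : ∀ (p q : Subset n) → Empty (p ∩ q) → ∣ p ∪ q ∣ ≡ ∣ p ∣ + ∣ q ∣
∣p∪q∣≡∣p∣+∣q∣ []          []          _        = refl
∣p∪q∣≡∣p∣+∣q∣ (true  ∷ p) (true  ∷ q) disjoint = ⊥-elim (disjoint (zero , here))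
∣p∪q∣≡∣p∣+∣q∣ (true  ∷ p) (false ∷ q) disjoint = cong suc (∣p∪q∣≡∣p∣+∣q∣ p q (drop-∷-Empty disjoint))
∣p∪q∣≡∣p∣+∣q∣ (false ∷ p) (true  ∷ q) disjoint =
  trans (cong suc (∣p∪q∣≡∣p∣+∣q∣ p q (drop-∷-Empty disjoint))) (sym (ℕP.+-suc _ _))
∣p∪q∣≡∣p∣+∣q∣ (false ∷ p) (false ∷ q) disjoint = ∣p∪q∣≡∣p∣+∣q∣ p q (drop-∷-Empty disjoint)

x∉p⇒∣⁅x⁆∪p∣≡1+∣p∣ : x ∉ p → ∣ ⁅ x ⁆ ∪ p ∣ ≡ suc ∣ p ∣
x∉p⇒∣⁅x⁆∪p∣≡1+∣p∣ {x = x} {p = p} x∉p =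
  trans (∣p∪q∣≡∣p∣+∣q∣ ⁅ x ⁆ p disjoint) (cong (_+ ∣ p ∣) (∣⁅x⁆∣≡1 x))
  where
  disjoint : Empty (⁅ x ⁆ ∩ p)
  disjoint (y , y∈⁅x⁆∩p) with x∈p∩q⁻ ⁅ x ⁆ p y∈⁅x⁆∩p
  ... | y∈⁅x⁆ , y∈p = x∉p (subst (_∈ p) (x∈⁅y⁆⇒x≡y x y∈⁅x⁆) y∈p)

x∉p-x : ∀ (p : Subset n) x → x ∉ p - x
x∉p-x p x x∈p-x = x∈p─q⇒x∉q p ⁅ x ⁆ x∈p-x (x∈⁅x⁆ x)

x∈p⇒⁅x⁆∪[p-x]≡p : x ∈ p → ⁅ x ⁆ ∪ (p - x) ≡ p
x∈p⇒⁅x⁆∪[p-x]≡p {x = x} {p = p} x∈p = ⊆-antisym ⊆p p⊆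
  where
  ⊆p : ⁅ x ⁆ ∪ (p - x) ⊆ p
  ⊆p = ∪-lub (x∈p⇒⁅x⁆⊆p x∈p) (p─q⊆p p ⁅ x ⁆)
  p⊆ : p ⊆ ⁅ x ⁆ ∪ (p - x)
  p⊆ {y} y∈p with y FinP.≟ x
  ... | yes refl = p⊆p∪q (p - x) (x∈⁅x⁆ x)
  ... | no  y≢x  = q⊆p∪q ⁅ x ⁆ (p - x) (x∈p∧x≢y⇒x∈p-y y∈p y≢x)

x∈p⇒1+∣p-x∣≡∣p∣ : x ∈ p → suc ∣ p - x ∣ ≡ ∣ p ∣
x∈p⇒1+∣p-x∣≡∣p∣ {x = x} {p = p} x∈p =
  trans (sym (x∉p⇒∣⁅x⁆∪p∣≡1+∣p∣ (x∉p-x p x))) (cong ∣_∣ (x∈p⇒⁅x⁆∪[p-x]≡p x∈p))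

replaceElement : ∀ {r : Subset n} → x ∈ p → p - x ⊆ r → ∣ p ∣ ≡ ∣ r ∣ →
                 ∃ λ y → y ∈ r × y ∉ p - x × ⁅ y ⁆ ∪ (p - x) ≡ r
replaceElement {x = x} {p = p} {r} x∈p p-x⊆r ∣p∣≡∣r∣ =
  let (y , y∈r , y∉p-x) = p⊈q⇒∃∈p∉q r (p - x) r⊈p-x in
  y , y∈r , y∉p-x ,
  p⊆q⇒∣q∣≤∣p∣⇒p≡q (∪-lub (x∈p⇒⁅x⁆⊆p y∈r) p-x⊆r)
                  (ℕP.≤-reflexive (trans (sym 1+∣p-x∣≡∣r∣) (sym (x∉p⇒∣⁅x⁆∪p∣≡1+∣p∣ y∉p-x))))
  where
  1+∣p-x∣≡∣r∣ : suc ∣ p - x ∣ ≡ ∣ r ∣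
  1+∣p-x∣≡∣r∣ = trans (x∈p⇒1+∣p-x∣≡∣p∣ x∈p) ∣p∣≡∣r∣
  r⊈p-x : ¬ (r ⊆ p - x)
  r⊈p-x r⊆p-x = ℕP.<⇒≱ (subst (∣ p - x ∣ ℕ.<_) 1+∣p-x∣≡∣r∣ (ℕP.n<1+n _)) (p⊆q⇒∣p∣≤∣q∣ r⊆p-x)

select : {P : Pred (Fin n) b} → Decidable P → Subset n
select {zero}  P? = []
select {suc n} P? = does (P? zero) ∷ select (P? ∘ suc)

∈-select⁺ : (P? : Decidable P) → P x → x ∈ select P?
∈-select⁺ {x = zero}  P? Px with P? zero
... | yes _   = here
... | no  ¬Px = ⊥-elim (¬Px Px)
∈-select⁺ {x = suc x} P? Px = there (∈-select⁺ (P? ∘ suc) Px)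

∈-select⁻ : (P? : Decidable P) → x ∈ select P? → P x
∈-select⁻ {x = zero}  P? x∈ with P? zero
∈-select⁻ {x = zero}  P? here | yes Px = Px
∈-select⁻ {x = suc x} P? (there x∈) = ∈-select⁻ (P? ∘ suc) x∈

∈-allSubsets : ∀ (J : Subset n) → J ∈ₗ allSubsets n
∈-allSubsets []          = here refl
∈-allSubsets (true  ∷ J) = ∈-++⁺ˡ (∈-map⁺ (true ∷_) (∈-allSubsets J))
∈-allSubsets {suc n} (false ∷ J) = ∈-++⁺ʳ (map (true ∷_) (allSubsets n)) (∈-map⁺ (false ∷_) (∈-allSubsets J))

weight-insert : ∀ (ℓ : Fin n → ℚ) → x ∉ p → weight ℓ (⁅ x ⁆ ∪ p) ≡ ℓ x ℚ.+ weight ℓ p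
weight-insert {x = zero}  {p = true  ∷ p} ℓ x∉p = ⊥-elim (x∉p here)
weight-insert {x = zero}  {p = false ∷ p} ℓ x∉p =
  cong (ℓ zero ℚ.+_) (trans (cong (weight (ℓ ∘ suc)) (∪-identityˡ p)) (sym (ℚP.+-identityˡ _)))
weight-insert {x = suc x} {p = b ∷ p}     ℓ x∉p = begin
  c ℚ.+ weight (ℓ ∘ suc) (⁅ x ⁆ ∪ p)   ≡⟨ cong (c ℚ.+_) (weight-insert (ℓ ∘ suc) (x∉p ∘ there)) ⟩
  c ℚ.+ (ℓ (suc x) ℚ.+ w)              ≡⟨ ℚP.+-assoc c _ w ⟨
  c ℚ.+ ℓ (suc x) ℚ.+ w                ≡⟨ cong (ℚ._+ w) (ℚP.+-comm c _) ⟩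
  ℓ (suc x) ℚ.+ c ℚ.+ w                ≡⟨ ℚP.+-assoc (ℓ (suc x)) c w ⟩
  ℓ (suc x) ℚ.+ (c ℚ.+ w)              ∎
  where
  open ≡-Reasoning
  c w : ℚ
  c = if b then ℓ zero else 0ℚ
  w = weight (ℓ ∘ suc) p

weight-remove : ∀ (ℓ : Fin n → ℚ) → x ∈ p → weight ℓ p ≡ ℓ x ℚ.+ weight ℓ (p - x)
weight-remove {x = x} {p = p} ℓ x∈p =
  trans (cong (weight ℓ) (sym (x∈p⇒⁅x⁆∪[p-x]≡p x∈p))) (weight-insert ℓ (x∉p-x p x))

least : {P : Pred (Fin m) b} → Decidable P → ∃ P → ∃ λ k → P k × (∀ i → i Fin.< k → ¬ P i)
least {m = suc m} P? (k , Pk) with P? zero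
... | yes P0 = zero , P0 , λ _ ()
... | no ¬P0 with k
...   | zero   = ⊥-elim (¬P0 Pk)
...   | suc k′ =
  let (k″ , Pk″ , below) = least (P? ∘ suc) (k′ , Pk) in
  suc k″ , Pk″ , λ { zero _ → ¬P0 ; (suc i) (s≤s i<k″) → below i i<k″ }

argmaxIn : (p : Subset n) (f : Fin n → ℕ) → Nonempty p → ∃ λ e → e ∈ p × (∀ x → x ∈ p → f x ℕ.≤ f e)
argmaxIn {n} p f (x₀ , x₀∈p) = e , e∈p , λ x x∈p → All.lookup (f[xs]≤f[argmax] x₀ xs) (∈-filter⁺ (_∈? p) (∈-allFin x) x∈p)
  where
  xs : List (Fin n)
  xs = filter (_∈? p) (allFin n)
  e : Fin n
  e = argmax f x₀ xs
  e∈p : e ∈ p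
  e∈p = argmax-all f x₀∈p (all-filter (_∈? p) (allFin n))

-- Defined through does, so that 𝟙 (suc m ℕ.≟ suc n) and 𝟙 (m ℕ.≟ n) agree definitionally.
𝟙 : {P : Set b} → Dec P → ℕ
𝟙 P? = if does P? then 1 else 0

count : {P : Pred X b} → Decidable P → List X → ℕ
count P? xs = length (filter P? xs)

count-∷ : (P? : Decidable P) → ∀ x xs → count P? (x ∷ xs) ≡ 𝟙 (P? x) + count P? xs
count-∷ P? x xs with does (P? x)
... | true  = refl
... | false = refl

count-++ : (P? : Decidable P) → ∀ xs ys → count P? (xs ++ ys) ≡ count P? xs + count P? ys
count-++ P? xs ys = trans (cong length (filter-++ P? xs ys)) (length-++ (filter P? xs))

count-map : (P? : Decidable P) (f : Y → X) → ∀ xs → count P? (map f xs) ≡ count (P? ∘ f) xs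
count-map P? f []       = refl
count-map P? f (x ∷ xs) = begin
  count P? (f x ∷ map f xs)            ≡⟨ count-∷ P? (f x) (map f xs) ⟩
  𝟙 (P? (f x)) + count P? (map f xs)   ≡⟨ cong (λ c → 𝟙 (P? (f x)) + c) (count-map P? f xs) ⟩
  𝟙 (P? (f x)) + count (P? ∘ f) xs     ≡⟨ count-∷ (P? ∘ f) x xs ⟨
  count (P? ∘ f) (x ∷ xs)              ∎
  where open ≡-Reasoning

count-filter : (P? : Decidable P) (Q? : Decidable Q) → ∀ xs →
               count Q? (filter P? xs) ≡ count (λ x → P? x ×-dec Q? x) xs
count-filter P? Q? []       = refl
count-filter P? Q? (x ∷ xs) with P? x
... | no  _ = count-filter P? Q? xs
... | yes _ with Q? x
...   | yes _ = cong suc (count-filter P? Q? xs)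
...   | no  _ = count-filter P? Q? xs

count-≐ : (P? : Decidable P) (Q? : Decidable Q) → P ≐ Q → ∀ xs → count P? xs ≡ count Q? xs
count-≐ P? Q? P≐Q xs = cong length (filter-≐ P? Q? P≐Q xs)

count-none : (P? : Decidable P) → (∀ x → ¬ P x) → ∀ xs → count P? xs ≡ 0
count-none P? ¬P []       = refl
count-none P? ¬P (x ∷ xs) with P? x
... | yes Px = ⊥-elim (¬P x Px)
... | no  _  = count-none P? ¬P xs

𝟙-cong : {P : Set a} {Q : Set b} → (P → Q) → (Q → P) → (P? : Dec P) (Q? : Dec Q) → 𝟙 P? ≡ 𝟙 Q?
𝟙-cong P→Q Q→P (yes _)  (yes _)  = refl
𝟙-cong P→Q Q→P (yes P)  (no ¬Q)  = ⊥-elim (¬Q (P→Q P))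
𝟙-cong P→Q Q→P (no ¬P)  (yes Q)  = ⊥-elim (¬P (Q→P Q))
𝟙-cong P→Q Q→P (no _)   (no _)   = refl

𝟙-no : {P : Set b} → ¬ P → (P? : Dec P) → 𝟙 P? ≡ 0
𝟙-no ¬P (yes P) = ⊥-elim (¬P P)
𝟙-no ¬P (no _)  = refl

count-tabulate : (P? : Decidable P) (f : Fin m → X) →
                 + count P? (tabulate f) ≡ ∑[ k < m ] (+ 𝟙 (P? (f k)))
count-tabulate {m = zero}  P? f = refl
count-tabulate {m = suc m} P? f = begin
  + count P? (tabulate f)                                      ≡⟨ cong +_ (count-∷ P? (f zero) (tabulate (f ∘ suc))) ⟩
  + (𝟙 (P? (f zero)) + count P? (tabulate (f ∘ suc)))          ≡⟨ ℤP.pos-+ (𝟙 (P? (f zero))) _ ⟩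
  + 𝟙 (P? (f zero)) ℤ.+ + count P? (tabulate (f ∘ suc))        ≡⟨ cong (λ s → + 𝟙 (P? (f zero)) ℤ.+ s) (count-tabulate P? (f ∘ suc)) ⟩
  ∑[ k < suc m ] (+ 𝟙 (P? (f k)))                              ∎
  where open ≡-Reasoning

∑-𝟙-≟ : (k₀ : Fin m) → ∑[ k < m ] (+ 𝟙 (k FinP.≟ k₀)) ≡ + 1
∑-𝟙-≟ {suc m} zero      = trans (cong (λ s → + 1 ℤ.+ s) (sum-replicate-zero m)) (ℤP.+-identityʳ (+ 1))
∑-𝟙-≟ {suc m} (suc k₀) = trans (ℤP.+-identityˡ _) (∑-𝟙-≟ k₀)

module _ {Q : Fin m → Pred X b} (P? : Decidable P) (Q? : ∀ k → Decidable (Q k))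
         (cover : ∀ {x} → P x → ∃ λ k → Q k x) (Q⇒P : ∀ {k x} → Q k x → P x)
         (disjoint : ∀ {k k′ x} → Q k x → Q k′ x → k ≡ k′) where

  𝟙-partition : ∀ x → + 𝟙 (P? x) ≡ ∑[ k < m ] (+ 𝟙 (Q? k x))
  𝟙-partition x with P? x
  ... | yes Px = let (k₀ , Qk₀x) = cover Px in
    sym (trans (sum-cong-≗ λ k → cong +_ (𝟙-cong (λ Qkx → disjoint Qkx Qk₀x) (λ { refl → Qk₀x }) (Q? k x) (k FinP.≟ k₀)))
               (∑-𝟙-≟ k₀))
  ... | no ¬Px = sym (trans (sum-cong-≗ λ k → cong +_ (𝟙-no (¬Px ∘ Q⇒P) (Q? k x))) (sum-replicate-zero m))

  count-partition : ∀ xs → + count P? xs ≡ ∑[ k < m ] (+ count (Q? k) xs)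
  count-partition []       = sym (sum-replicate-zero m)
  count-partition (x ∷ xs) = begin
    + count P? (x ∷ xs)                                              ≡⟨ cong +_ (count-∷ P? x xs) ⟩
    + (𝟙 (P? x) + count P? xs)                                       ≡⟨ ℤP.pos-+ (𝟙 (P? x)) _ ⟩
    + 𝟙 (P? x) ℤ.+ + count P? xs                                     ≡⟨ cong₂ ℤ._+_ (𝟙-partition x) (count-partition xs) ⟩
    ∑[ k < m ] (+ 𝟙 (Q? k x)) ℤ.+ ∑[ k < m ] (+ count (Q? k) xs)          ≡⟨ ∑-distrib-+ (λ k → + 𝟙 (Q? k x)) _ ⟨
    ∑[ k < m ] (+ 𝟙 (Q? k x) ℤ.+ + count (Q? k) xs)                   ≡⟨ sum-cong-≗ (λ k → sym (ℤP.pos-+ (𝟙 (Q? k x)) _)) ⟩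
    ∑[ k < m ] (+ (𝟙 (Q? k x) + count (Q? k) xs))                     ≡⟨ sum-cong-≗ (λ k → cong +_ (count-∷ (Q? k) x xs)) ⟨
    ∑[ k < m ] (+ count (Q? k) (x ∷ xs))                                ∎
    where open ≡-Reasoning

count-allSubsets-suc : (P? : Decidable P) →
  count P? (allSubsets (suc n)) ≡ count (P? ∘ (true ∷_)) (allSubsets n) + count (P? ∘ (false ∷_)) (allSubsets n)
count-allSubsets-suc {n = n} P? =
  trans (count-++ P? (map (true ∷_) (allSubsets n)) _)
        (cong₂ _+_ (count-map P? (true ∷_) (allSubsets n)) (count-map P? (false ∷_) (allSubsets n)))

HasCount-≐ : ∀ {P Q : Fin m → Set} {h} → (∀ k → P k ⇔ Q k) → HasCount P h → HasCount Q h
HasCount-≐ P⇔Q (ks , unique , ∈⇔P , length≡h) =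
  ks , unique , (λ k → ⇔-trans (∈⇔P k) (P⇔Q k)) , length≡h

foldr-⊔-≤ : ∀ (f : X → ℕ) xs {c} → (∀ x → x ∈ₗ xs → f x ℕ.≤ c) → foldr (λ x r → f x ℕ.⊔ r) 0 xs ℕ.≤ c
foldr-⊔-≤ f []       bound = z≤n
foldr-⊔-≤ f (x ∷ xs) bound = ℕP.⊔-lub (bound x (here refl)) (foldr-⊔-≤ f xs (λ y → bound y ∘ there))

≤-foldr-⊔ : ∀ (f : X → ℕ) {x xs} → x ∈ₗ xs → f x ℕ.≤ foldr (λ x r → f x ℕ.⊔ r) 0 xs
≤-foldr-⊔ f {xs = y ∷ xs} (here refl) = ℕP.m≤m⊔n (f y) _
≤-foldr-⊔ f {xs = y ∷ xs} (there x∈) = ℕP.≤-trans (≤-foldr-⊔ f x∈) (ℕP.m≤n⊔m (f y) _)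

foldr-+-map-applyUpTo : ∀ (t : ℕ → ℤ) f m → foldr ℤ._+_ (+ 0) (map t (applyUpTo f m)) ≡ ∑[ i < m ] t (f (toℕ i))
foldr-+-map-applyUpTo t f zero    = refl
foldr-+-map-applyUpTo t f (suc m) = cong (λ s → t (f 0) ℤ.+ s) (foldr-+-map-applyUpTo t (f ∘ suc) m)

-- Boolean intervals and their h-vectors

-- The number of i-subsets in an interval [A, D] of the Boolean lattice with ∣ A ∣ = a and
-- ∣ D ─ A ∣ = x, i.e. x C (i ∸ a) when a ≤ i and 0 otherwise.
intervalCount : ℕ → ℕ → ℕ → ℕ
intervalCount zero    x i       = x C i
intervalCount (suc a) x zero    = 0
intervalCount (suc a) x (suc i) = intervalCount a x i

intervalCount-zero : ∀ a x → intervalCount a (suc x) zero ≡ intervalCount a x zero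
intervalCount-zero zero    x = refl
intervalCount-zero (suc a) x = refl

intervalCount-pascal : ∀ a x i → intervalCount a (suc x) (suc i) ≡ intervalCount a x i + intervalCount a x (suc i)
intervalCount-pascal zero    x i       = sym (nCk+nC[k+1]≡[n+1]C[k+1] x i)
intervalCount-pascal (suc a) x zero    = intervalCount-zero a x
intervalCount-pascal (suc a) x (suc i) = intervalCount-pascal a x i

IntervalLayer : Subset n → Subset n → ℕ → Pred (Subset n) 0ℓ
IntervalLayer A D i J = A ⊆ J × J ⊆ D × ∣ J ∣ ≡ i

intervalLayer? : (A D : Subset n) (i : ℕ) → Decidable (IntervalLayer A D i)
intervalLayer? A D i J = A ⊆? J ×-dec J ⊆? D ×-dec ∣ J ∣ ℕ.≟ i

count-intervalLayer-outside : ∀ {A D : Subset n} {d} i Js →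
  count (intervalLayer? (false ∷ A) (d ∷ D) i ∘ (false ∷_)) Js ≡ count (intervalLayer? A D i) Js
count-intervalLayer-outside i = count-≐ _ _
  ((λ (A⊆J , J⊆D , ∣J∣≡i) → drop-∷-⊆ A⊆J , drop-∷-⊆ J⊆D , ∣J∣≡i) ,
   (λ (A⊆J , J⊆D , ∣J∣≡i) → out⊆ A⊆J , out⊆ J⊆D , ∣J∣≡i))

count-intervalLayer-inside : ∀ {A D : Subset n} {a} i Js →
  count (intervalLayer? (a ∷ A) (true ∷ D) (suc i) ∘ (true ∷_)) Js ≡ count (intervalLayer? A D i) Js
count-intervalLayer-inside {n} {a = a} i = count-≐ _ _
  ((λ (A⊆J , J⊆D , ∣J∣≡i) → drop-∷-⊆ A⊆J , drop-∷-⊆ J⊆D , ℕP.suc-injective ∣J∣≡i) ,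
   (λ (A⊆J , J⊆D , ∣J∣≡i) → ∷⊆inside a A⊆J , in⊆in J⊆D , cong suc ∣J∣≡i))
  where
  ∷⊆inside : ∀ b {p q : Subset n} → p ⊆ q → b ∷ p ⊆ true ∷ q
  ∷⊆inside true  = in⊆in
  ∷⊆inside false = out⊆

count-intervalLayer : ∀ {A D : Subset n} → A ⊆ D → ∀ i →
  count (intervalLayer? A D i) (allSubsets n) ≡ intervalCount ∣ A ∣ ∣ D ─ A ∣ i
count-intervalLayer {A = []}        {[]}        _   zero    = refl
count-intervalLayer {A = []}        {[]}        _   (suc i) = refl
count-intervalLayer {A = true  ∷ A} {false ∷ D} A⊆D i with A⊆D here
... | ()
count-intervalLayer {n = suc n} {A = true ∷ A} {true ∷ D} A⊆D i
  rewrite count-allSubsets-suc (intervalLayer? (true ∷ A) (true ∷ D) i)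
        | count-none (intervalLayer? (true ∷ A) (true ∷ D) i ∘ (false ∷_)) (λ _ (A⊆J , _) → case A⊆J here of λ ()) (allSubsets n)
  = trans (ℕP.+-identityʳ _) (insideCount i)
  where
  insideCount : ∀ i → count (intervalLayer? (true ∷ A) (true ∷ D) i ∘ (true ∷_)) (allSubsets n) ≡ intervalCount (suc ∣ A ∣) ∣ D ─ A ∣ i
  insideCount zero    = count-none _ (λ _ (_ , _ , ∣J∣≡0) → ℕP.1+n≢0 ∣J∣≡0) (allSubsets n)
  insideCount (suc i) = trans (count-intervalLayer-inside i (allSubsets n)) (count-intervalLayer (drop-∷-⊆ A⊆D) i)
count-intervalLayer {n = suc n} {A = false ∷ A} {true ∷ D} A⊆D i
  rewrite count-allSubsets-suc (intervalLayer? (false ∷ A) (true ∷ D) i)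
        | count-intervalLayer-outside {A = A} {D} {true} i (allSubsets n)
  = splitCount i
  where
  IH : ∀ i → count (intervalLayer? A D i) (allSubsets n) ≡ intervalCount ∣ A ∣ ∣ D ─ A ∣ i
  IH = count-intervalLayer (drop-∷-⊆ A⊆D)
  splitCount : ∀ i → count (intervalLayer? (false ∷ A) (true ∷ D) i ∘ (true ∷_)) (allSubsets n) + count (intervalLayer? A D i) (allSubsets n)
                   ≡ intervalCount ∣ A ∣ (suc ∣ D ─ A ∣) i
  splitCount zero    = trans (cong₂ _+_ (count-none _ (λ _ (_ , _ , ∣J∣≡0) → ℕP.1+n≢0 ∣J∣≡0) (allSubsets n)) (IH zero))
                             (sym (intervalCount-zero ∣ A ∣ ∣ D ─ A ∣))
  splitCount (suc i) = trans (cong₂ _+_ (trans (count-intervalLayer-inside i (allSubsets n)) (IH i)) (IH (suc i)))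
                             (sym (intervalCount-pascal ∣ A ∣ ∣ D ─ A ∣ i))
count-intervalLayer {n = suc n} {A = false ∷ A} {false ∷ D} A⊆D i
  rewrite count-allSubsets-suc (intervalLayer? (false ∷ A) (false ∷ D) i)
        | count-none (intervalLayer? (false ∷ A) (false ∷ D) i ∘ (true ∷_)) (λ _ (_ , J⊆D , _) → case J⊆D here of λ ()) (allSubsets n)
        | count-intervalLayer-outside {A = A} {D} {false} i (allSubsets n)
  = count-intervalLayer (drop-∷-⊆ A⊆D) i

nCk*k!*[n∸k]!≡n! : ∀ {n k} → k ℕ.≤ n → (n C k) ℕ.* (k ! ℕ.* (n ∸ k) !) ≡ n !
nCk*k!*[n∸k]!≡n! {n} {k} k≤n = begin
  (n C k) ℕ.* (k ! ℕ.* (n ∸ k) !)                    ≡⟨ cong (ℕ._* (k ! ℕ.* (n ∸ k) !)) (nCk≡n!/k![n-k]! k≤n) ⟩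
  n ! / (k ! ℕ.* (n ∸ k) !) ℕ.* (k ! ℕ.* (n ∸ k) !)  ≡⟨ m/n*n≡m (k![n∸k]!∣n! k≤n) ⟩
  n !                                                 ∎
  where
  open ≡-Reasoning
  instance _ = k ℕP.!* (n ∸ k) !≢0

-- Both sides count the pairs I ⊆ J of an i-set inside a j-set inside an x-set.
trinomial : ∀ x j i → i ℕ.≤ j → (x C i) ℕ.* ((x ∸ i) C (j ∸ i)) ≡ (x C j) ℕ.* (j C i)
trinomial x j i i≤j with j ℕ.≤? x
... | no  j≰x with i ℕ.≤? x
...   | yes i≤x = trans (cong ((x C i) ℕ.*_) (k>n⇒nCk≡0 (ℕP.∸-monoˡ-< (ℕP.≰⇒> j≰x) i≤x)))
                        (trans (ℕP.*-zeroʳ (x C i)) (cong (ℕ._* (j C i)) (sym (k>n⇒nCk≡0 (ℕP.≰⇒> j≰x)))))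
...   | no  i≰x = trans (cong (ℕ._* ((x ∸ i) C (j ∸ i))) (k>n⇒nCk≡0 (ℕP.≰⇒> i≰x)))
                        (cong (ℕ._* (j C i)) (sym (k>n⇒nCk≡0 (ℕP.≰⇒> j≰x))))
trinomial x j i i≤j | yes j≤x = ℕP.*-cancelʳ-≡ _ _ (i ! ℕ.* ((j ∸ i) ! ℕ.* (x ∸ j) !)) (trans lhs (sym rhs))
  where
  open ≡-Reasoning
  instance _ = ℕP.m*n≢0 (i !) ((j ∸ i) ! ℕ.* (x ∸ j) !) {{i ℕP.!≢0}} {{(j ∸ i) ℕP.!* (x ∸ j) !≢0}}
  rearrange : ∀ a b c d → a ℕ.* b ℕ.* (c ℕ.* d) ≡ a ℕ.* (c ℕ.* (b ℕ.* d))
  rearrange = solve-∀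
  reassociate : ∀ a b c d e → a ℕ.* b ℕ.* (c ℕ.* (d ℕ.* e)) ≡ a ℕ.* (b ℕ.* (c ℕ.* d) ℕ.* e)
  reassociate = solve-∀
  [x∸i]∸[j∸i]≡x∸j : (x ∸ i) ∸ (j ∸ i) ≡ x ∸ j
  [x∸i]∸[j∸i]≡x∸j = trans (ℕP.∸-+-assoc x i (j ∸ i)) (cong (x ∸_) (ℕP.m+[n∸m]≡n i≤j))
  lhs : (x C i) ℕ.* ((x ∸ i) C (j ∸ i)) ℕ.* (i ! ℕ.* ((j ∸ i) ! ℕ.* (x ∸ j) !)) ≡ x !
  lhs = begin
    (x C i) ℕ.* ((x ∸ i) C (j ∸ i)) ℕ.* (i ! ℕ.* ((j ∸ i) ! ℕ.* (x ∸ j) !))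
      ≡⟨ rearrange (x C i) _ (i !) _ ⟩
    (x C i) ℕ.* (i ! ℕ.* (((x ∸ i) C (j ∸ i)) ℕ.* ((j ∸ i) ! ℕ.* (x ∸ j) !)))
      ≡⟨ cong (λ y → (x C i) ℕ.* (i ! ℕ.* (((x ∸ i) C (j ∸ i)) ℕ.* ((j ∸ i) ! ℕ.* y !)))) (sym [x∸i]∸[j∸i]≡x∸j) ⟩
    (x C i) ℕ.* (i ! ℕ.* (((x ∸ i) C (j ∸ i)) ℕ.* ((j ∸ i) ! ℕ.* ((x ∸ i) ∸ (j ∸ i)) !)))
      ≡⟨ cong (λ y → (x C i) ℕ.* (i ! ℕ.* y)) (nCk*k!*[n∸k]!≡n! (ℕP.∸-monoˡ-≤ i j≤x)) ⟩
    (x C i) ℕ.* (i ! ℕ.* (x ∸ i) !)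
      ≡⟨ nCk*k!*[n∸k]!≡n! (ℕP.≤-trans i≤j j≤x) ⟩
    x ! ∎
  rhs : (x C j) ℕ.* (j C i) ℕ.* (i ! ℕ.* ((j ∸ i) ! ℕ.* (x ∸ j) !)) ≡ x !
  rhs = begin
    (x C j) ℕ.* (j C i) ℕ.* (i ! ℕ.* ((j ∸ i) ! ℕ.* (x ∸ j) !))
      ≡⟨ reassociate (x C j) (j C i) (i !) ((j ∸ i) !) ((x ∸ j) !) ⟩
    (x C j) ℕ.* ((j C i) ℕ.* (i ! ℕ.* (j ∸ i) !) ℕ.* (x ∸ j) !)
      ≡⟨ cong (λ y → (x C j) ℕ.* (y ℕ.* (x ∸ j) !)) (nCk*k!*[n∸k]!≡n! i≤j) ⟩
    (x C j) ℕ.* (j ! ℕ.* (x ∸ j) !)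
      ≡⟨ nCk*k!*[n∸k]!≡n! j≤x ⟩
    x ! ∎

module _ where
  open import Algebra.Properties.Semiring.Mult ℤP.+-*-semiring using () renaming (_×_ to _·_)
  open import Algebra.Properties.Semiring.Exp ℤP.+-*-semiring using (_^_)
  open import Algebra.Properties.CommutativeSemiring.Binomial ℤP.+-*-commutativeSemiring using (theorem)

  private
    ·≡pos* : ∀ n z → n · z ≡ + n ℤ.* z
    ·≡pos* zero    z = sym (ℤP.*-zeroˡ z)
    ·≡pos* (suc n) z = begin
      z ℤ.+ n · z            ≡⟨ cong₂ ℤ._+_ (sym (ℤP.*-identityˡ z)) (·≡pos* n z) ⟩
      + 1 ℤ.* z ℤ.+ + n ℤ.* z  ≡⟨ ℤP.*-distribʳ-+ z (+ 1) (+ n) ⟨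
      + suc n ℤ.* z          ∎
      where open ≡-Reasoning

    ^≡^ : ∀ z k → z ^ k ≡ z ℤ.^ k
    ^≡^ z zero    = refl
    ^≡^ z (suc k) = cong (z ℤ.*_) (^≡^ z k)

  ∑-alternating-binomial : ∀ j → ∑[ i < suc j ] (+ (j C toℕ i) ℤ.* -1ℤ ℤ.^ (j ∸ toℕ i)) ≡ + 𝟙 (0 ℕ.≟ j)
  ∑-alternating-binomial j = sym (begin
    + 𝟙 (0 ℕ.≟ j)                                                        ≡⟨ zero^j j ⟨
    (+ 1 ℤ.+ -1ℤ) ^ j                                                    ≡⟨ theorem j (+ 1) -1ℤ ⟩
    ∑[ i < suc j ] ((j C toℕ i) · ((+ 1) ^ toℕ i ℤ.* -1ℤ ^ (j ∸ toℕ i)))   ≡⟨ sum-cong-≗ {suc j} term ⟩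
    ∑[ i < suc j ] (+ (j C toℕ i) ℤ.* -1ℤ ℤ.^ (j ∸ toℕ i))               ∎)
    where
    open ≡-Reasoning
    zero^j : ∀ j → (+ 1 ℤ.+ -1ℤ) ^ j ≡ + 𝟙 (0 ℕ.≟ j)
    zero^j zero    = refl
    zero^j (suc j) = ℤP.*-zeroˡ ((+ 1 ℤ.+ -1ℤ) ^ j)
    term : ∀ i → (j C toℕ i) · ((+ 1) ^ toℕ i ℤ.* -1ℤ ^ (j ∸ toℕ i)) ≡ + (j C toℕ i) ℤ.* -1ℤ ℤ.^ (j ∸ toℕ i)
    term i = begin
      (j C toℕ i) · ((+ 1) ^ toℕ i ℤ.* -1ℤ ^ (j ∸ toℕ i))         ≡⟨ ·≡pos* (j C toℕ i) _ ⟩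
      + (j C toℕ i) ℤ.* ((+ 1) ^ toℕ i ℤ.* -1ℤ ^ (j ∸ toℕ i))     ≡⟨ cong₂ (λ u v → + (j C toℕ i) ℤ.* (u ℤ.* v)) (trans (^≡^ (+ 1) (toℕ i)) (ℤP.^-zeroˡ (toℕ i))) (^≡^ -1ℤ (j ∸ toℕ i)) ⟩
      + (j C toℕ i) ℤ.* (+ 1 ℤ.* -1ℤ ℤ.^ (j ∸ toℕ i))           ≡⟨ cong (+ (j C toℕ i) ℤ.*_) (ℤP.*-identityˡ _) ⟩
      + (j C toℕ i) ℤ.* -1ℤ ℤ.^ (j ∸ toℕ i)                     ∎

-- The coefficient form of the fact that the h-polynomial of a Boolean interval [A, D] is x ^ ∣ A ∣.
∑-alternating-intervalCount : ∀ j a x →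
  ∑[ i < suc j ] (-1ℤ ℤ.^ (j ∸ toℕ i) ℤ.* + ((a + x ∸ toℕ i) C (j ∸ toℕ i)) ℤ.* + intervalCount a x (toℕ i))
  ≡ + 𝟙 (a ℕ.≟ j)
∑-alternating-intervalCount zero    (suc a) x =
  trans (ℤP.+-identityʳ (first ℤ.* + 0)) (ℤP.*-zeroʳ first)
  where
  first : ℤ
  first = -1ℤ ℤ.^ 0 ℤ.* + ((suc a + x) C 0)
∑-alternating-intervalCount (suc j) (suc a) x =
  trans (cong (ℤ._+ rest) (ℤP.*-zeroʳ (-1ℤ ℤ.^ suc j ℤ.* + ((suc a + x) C suc j))))
        (trans (ℤP.+-identityˡ rest) (∑-alternating-intervalCount j a x))
  where
  rest : ℤ
  rest = ∑[ i < suc j ] (-1ℤ ℤ.^ (j ∸ toℕ i) ℤ.* + ((a + x ∸ toℕ i) C (j ∸ toℕ i)) ℤ.* + intervalCount a x (toℕ i))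
∑-alternating-intervalCount j zero x = begin
  ∑[ i < suc j ] (-1ℤ ℤ.^ (j ∸ toℕ i) ℤ.* + ((x ∸ toℕ i) C (j ∸ toℕ i)) ℤ.* + (x C toℕ i))
    ≡⟨ sum-cong-≗ {suc j} (λ i → term (toℕ i) (FinP.toℕ≤pred[n] i)) ⟩
  ∑[ i < suc j ] (+ (x C j) ℤ.* (+ (j C toℕ i) ℤ.* -1ℤ ℤ.^ (j ∸ toℕ i)))
    ≡⟨ *-distribˡ-sum {suc j} (+ (x C j)) (λ i → + (j C toℕ i) ℤ.* -1ℤ ℤ.^ (j ∸ toℕ i)) ⟨
  + (x C j) ℤ.* ∑[ i < suc j ] (+ (j C toℕ i) ℤ.* -1ℤ ℤ.^ (j ∸ toℕ i))
    ≡⟨ cong (+ (x C j) ℤ.*_) (∑-alternating-binomial j) ⟩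
  + (x C j) ℤ.* + 𝟙 (0 ℕ.≟ j)
    ≡⟨ absorb j ⟩
  + 𝟙 (0 ℕ.≟ j) ∎
  where
  open ≡-Reasoning
  swap : ∀ s b c → s ℤ.* b ℤ.* c ≡ s ℤ.* (c ℤ.* b)
  swap = ℤ-Solver.solve-∀
  shuffle : ∀ s b c → s ℤ.* (b ℤ.* c) ≡ b ℤ.* (c ℤ.* s)
  shuffle = ℤ-Solver.solve-∀
  term : ∀ i → i ℕ.≤ j →
         -1ℤ ℤ.^ (j ∸ i) ℤ.* + ((x ∸ i) C (j ∸ i)) ℤ.* + (x C i) ≡ + (x C j) ℤ.* (+ (j C i) ℤ.* -1ℤ ℤ.^ (j ∸ i))
  term i i≤j = begin
    -1ℤ ℤ.^ (j ∸ i) ℤ.* + ((x ∸ i) C (j ∸ i)) ℤ.* + (x C i)   ≡⟨ swap (-1ℤ ℤ.^ (j ∸ i)) (+ ((x ∸ i) C (j ∸ i))) (+ (x C i)) ⟩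
    -1ℤ ℤ.^ (j ∸ i) ℤ.* (+ (x C i) ℤ.* + ((x ∸ i) C (j ∸ i))) ≡⟨ cong (-1ℤ ℤ.^ (j ∸ i) ℤ.*_) (ℤP.pos-* (x C i) _) ⟨
    -1ℤ ℤ.^ (j ∸ i) ℤ.* + ((x C i) ℕ.* ((x ∸ i) C (j ∸ i)))   ≡⟨ cong (λ y → -1ℤ ℤ.^ (j ∸ i) ℤ.* + y) (trinomial x j i i≤j) ⟩
    -1ℤ ℤ.^ (j ∸ i) ℤ.* + ((x C j) ℕ.* (j C i))               ≡⟨ cong (-1ℤ ℤ.^ (j ∸ i) ℤ.*_) (ℤP.pos-* (x C j) (j C i)) ⟩
    -1ℤ ℤ.^ (j ∸ i) ℤ.* (+ (x C j) ℤ.* + (j C i))             ≡⟨ shuffle (-1ℤ ℤ.^ (j ∸ i)) (+ (x C j)) (+ (j C i)) ⟩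
    + (x C j) ℤ.* (+ (j C i) ℤ.* -1ℤ ℤ.^ (j ∸ i))             ∎
  absorb : ∀ j → + (x C j) ℤ.* + 𝟙 (0 ℕ.≟ j) ≡ + 𝟙 (0 ℕ.≟ j)
  absorb zero    = refl
  absorb (suc j) = ℤP.*-zeroʳ (+ (x C suc j))

-- Matroids

module _ {n} (M : Matroid n) where

  indep? : Decidable (Indep M)
  indep? A = T? (indep M A)

  MaximalIn : Subset n → Subset n → Set
  MaximalIn W G = ∀ x → x ∈ W → x ∉ G → ¬ Indep M (⁅ x ⁆ ∪ G)

  private
    greedy : (W : Subset n) (xs : List (Fin n)) (G : Subset n) → Indep M G →
             Σ (Subset n) λ H → G ⊆ H × H ⊆ G ∪ W × Indep M H ×
               (∀ x → x ∈ₗ xs → x ∈ W → x ∉ H → ¬ Indep M (⁅ x ⁆ ∪ H))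
    greedy W []       G iG = G , id , p⊆p∪q W , iG , λ _ ()
    greedy W (y ∷ ys) G iG with y ∈? W ×-dec indep? (⁅ y ⁆ ∪ G)
    ... | yes (y∈W , iyG) =
      let (H , yG⊆H , H⊆ , iH , maxH) = greedy W ys (⁅ y ⁆ ∪ G) iyG in
      H , ⊆-trans (q⊆p∪q ⁅ y ⁆ G) yG⊆H
        , ⊆-trans H⊆ (∪-lub (∪-lub (⊆-trans (x∈p⇒⁅x⁆⊆p y∈W) (q⊆p∪q G W)) (p⊆p∪q W)) (q⊆p∪q G W))
        , iH
        , λ { x (here refl) _ x∉H _ → x∉H (yG⊆H (p⊆p∪q G (x∈⁅x⁆ x)))
            ; x (there x∈ys) → maxH x x∈ys }
    ... | no ¬yW-indep =
      let (H , G⊆H , H⊆ , iH , maxH) = greedy W ys G iG in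
      H , G⊆H , H⊆ , iH
        , λ { x (here refl) x∈W _ ixH →
                ¬yW-indep (x∈W , indep-⊆ M (∪-lub (p⊆p∪q H) (⊆-trans G⊆H (q⊆p∪q ⁅ x ⁆ H))) ixH)
            ; x (there x∈ys) → maxH x x∈ys }

  extendWithin : (W G : Subset n) → Indep M G →
                 Σ (Subset n) λ H → G ⊆ H × H ⊆ G ∪ W × Indep M H × MaximalIn W H
  extendWithin W G iG =
    let (H , G⊆H , H⊆ , iH , maxH) = greedy W (allFin n) G iG in
    H , G⊆H , H⊆ , iH , λ x → maxH x (∈-allFin x)

  maximalIn⇒∣∣≤ : ∀ {W G H} → Indep M G → MaximalIn W G → H ⊆ W → Indep M H → ∣ H ∣ ℕ.≤ ∣ G ∣
  maximalIn⇒∣∣≤ {G = G} {H} iG maxG H⊆W iH with ∣ G ∣ ℕ.<? ∣ H ∣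
  ... | no  ∣G∣≮∣H∣ = ℕP.≮⇒≥ ∣G∣≮∣H∣
  ... | yes ∣G∣<∣H∣ =
    let (x , x∈H , x∉G , ixG) = indep-aug M iG iH ∣G∣<∣H∣ in ⊥-elim (maxG x (H⊆W x∈H) x∉G ixG)

  basis⇒maximalIn⊤ : ∀ {A} → IsBasis M A → MaximalIn ⊤ A
  basis⇒maximalIn⊤ (_ , maxA) x _ = maxA x

  basis⇒∣∣≤ : ∀ {A X} → IsBasis M A → Indep M X → ∣ X ∣ ℕ.≤ ∣ A ∣
  basis⇒∣∣≤ bA iX = maximalIn⇒∣∣≤ (proj₁ bA) (basis⇒maximalIn⊤ bA) (λ _ → ∈⊤) iX

  basis-∣∣-unique : ∀ {A B} → IsBasis M A → IsBasis M B → ∣ A ∣ ≡ ∣ B ∣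
  basis-∣∣-unique bA bB = ℕP.≤-antisym (basis⇒∣∣≤ bB (proj₁ bA)) (basis⇒∣∣≤ bA (proj₁ bB))

  indep∧∣∣≡⇒basis : ∀ {A X} → IsBasis M A → Indep M X → ∣ X ∣ ≡ ∣ A ∣ → IsBasis M X
  indep∧∣∣≡⇒basis {A} {X} bA iX ∣X∣≡∣A∣ = iX , λ x x∉X ixX →
    ℕP.<-irrefl refl (begin-strict
      ∣ A ∣            ≡⟨ ∣X∣≡∣A∣ ⟨
      ∣ X ∣            <⟨ ℕP.n<1+n ∣ X ∣ ⟩
      suc ∣ X ∣        ≡⟨ x∉p⇒∣⁅x⁆∪p∣≡1+∣p∣ x∉X ⟨
      ∣ ⁅ x ⁆ ∪ X ∣    ≤⟨ basis⇒∣∣≤ bA ixX ⟩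
      ∣ A ∣            ∎)
    where open ℕP.≤-Reasoning

  extendToBasis : ∀ {X} → Indep M X → ∃ λ A → IsBasis M A × X ⊆ A
  extendToBasis {X} iX =
    let (A , X⊆A , _ , iA , maxA) = extendWithin ⊤ X iX in A , (iA , λ x x∉A → maxA x ∈⊤ x∉A) , X⊆A

  -- Y lies in the span of A and e ∉ span A, hence e ∉ span Y.
  spanned⇒insert-indep : ∀ {A Y e} → e ∉ A → Indep M (⁅ e ⁆ ∪ A) → Indep M Y →
                         (∀ y → y ∈ Y → y ∉ A → ¬ Indep M (⁅ y ⁆ ∪ A)) → Indep M (⁅ e ⁆ ∪ Y)
  spanned⇒insert-indep {A} {Y} {e} e∉A ieA iY Y⊆spanA
    with extendWithin A Y iY
  ... | S , Y⊆S , S⊆Y∪A , iS , maxS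
    with indep-aug M iS ieA (ℕP.≤-<-trans ∣S∣≤∣A∣ (subst (∣ A ∣ ℕ.<_) (sym (x∉p⇒∣⁅x⁆∪p∣≡1+∣p∣ e∉A)) (ℕP.n<1+n _)))
    where
    ∣S∣≤∣A∣ : ∣ S ∣ ℕ.≤ ∣ A ∣
    ∣S∣≤∣A∣ with ∣ A ∣ ℕ.<? ∣ S ∣
    ... | no  ∣A∣≮∣S∣ = ℕP.≮⇒≥ ∣A∣≮∣S∣
    ... | yes ∣A∣<∣S∣ with indep-aug M (indep-⊆ M (q⊆p∪q ⁅ e ⁆ A) ieA) iS ∣A∣<∣S∣
    ...   | x , x∈S , x∉A , ixA with x∈p∪q⁻ Y A (S⊆Y∪A x∈S)
    ...     | inj₁ x∈Y = ⊥-elim (Y⊆spanA x x∈Y x∉A ixA)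
    ...     | inj₂ x∈A = ⊥-elim (x∉A x∈A)
  ... | x , x∈eA , x∉S , ixS with x∈p∪q⁻ ⁅ e ⁆ A x∈eA
  ...   | inj₁ x∈⁅e⁆ rewrite x∈⁅y⁆⇒x≡y e x∈⁅e⁆ = indep-⊆ M (∪-lub (p⊆p∪q S) (⊆-trans Y⊆S (q⊆p∪q ⁅ e ⁆ S))) ixS
  ...   | inj₂ x∈A = ⊥-elim (maxS x x∈A x∉S ixS)

module _ {n} (M : Matroid n) (ℓ : Fin n → ℚ) {B₀ : Subset n} (bB₀ : IsBasis M B₀)
         (B₀-lightest : ∀ D → IsBasis M D → D ≢ B₀ → weight ℓ B₀ ℚ.< weight ℓ D) where

  lighterThan : Fin n → Subset n
  lighterThan e = select (λ y → y ∈? B₀ ×-dec ℓ y ℚP.<? ℓ e)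

  -- Otherwise a basis D ∋ e inside ⁅ e ⁆ ∪ B₀ would be B₀ with some x exchanged for e,
  -- where x is no lighter than e, so D would weigh no more than B₀.
  lighter-insert-dependent : ∀ {e} → e ∉ B₀ → ¬ Indep M (⁅ e ⁆ ∪ lighterThan e)
  lighter-insert-dependent {e} e∉B₀ ieL with extendWithin M B₀ (⁅ e ⁆ ∪ lighterThan e) ieL
  ... | D , eL⊆D , D⊆eL∪B₀ , iD , maxD =
    ℚP.<-irrefl refl (ℚP.<-≤-trans (B₀-lightest D bD D≢B₀) (exchange (replaceElement e∈D D-e⊆B₀ ∣D∣≡∣B₀∣)))
    where
    L : Subset n
    L = lighterThan e
    ∣D∣≡∣B₀∣ : ∣ D ∣ ≡ ∣ B₀ ∣
    ∣D∣≡∣B₀∣ = ℕP.≤-antisym (basis⇒∣∣≤ M bB₀ iD) (maximalIn⇒∣∣≤ M iD maxD id (proj₁ bB₀))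
    bD : IsBasis M D
    bD = indep∧∣∣≡⇒basis M bB₀ iD ∣D∣≡∣B₀∣
    e∈D : e ∈ D
    e∈D = eL⊆D (p⊆p∪q L (x∈⁅x⁆ e))
    D≢B₀ : D ≢ B₀
    D≢B₀ D≡B₀ = e∉B₀ (subst (e ∈_) D≡B₀ e∈D)
    D-e⊆B₀ : D - e ⊆ B₀
    D-e⊆B₀ {y} y∈D-e with x∈p∪q⁻ (⁅ e ⁆ ∪ L) B₀ (D⊆eL∪B₀ (p─q⊆p D ⁅ e ⁆ y∈D-e))
    ... | inj₂ y∈B₀ = y∈B₀
    ... | inj₁ y∈eL with x∈p∪q⁻ ⁅ e ⁆ L y∈eL
    ...   | inj₁ y∈⁅e⁆ = ⊥-elim (x∈p─q⇒x∉q D ⁅ e ⁆ y∈D-e y∈⁅e⁆)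
    ...   | inj₂ y∈L   = proj₁ (∈-select⁻ _ y∈L)
    exchange : (∃ λ x → x ∈ B₀ × x ∉ D - e × ⁅ x ⁆ ∪ (D - e) ≡ B₀) → weight ℓ D ℚ.≤ weight ℓ B₀
    exchange (x , x∈B₀ , x∉D-e , x+[D-e]≡B₀) = begin
      weight ℓ D                       ≡⟨ weight-remove ℓ e∈D ⟩
      ℓ e ℚ.+ weight ℓ (D - e)         ≤⟨ ℚP.+-monoˡ-≤ (weight ℓ (D - e)) ℓe≤ℓx ⟩
      ℓ x ℚ.+ weight ℓ (D - e)         ≡⟨ weight-insert ℓ x∉D-e ⟨
      weight ℓ (⁅ x ⁆ ∪ (D - e))       ≡⟨ cong (weight ℓ) x+[D-e]≡B₀ ⟩
      weight ℓ B₀                      ∎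
      where
      open ℚP.≤-Reasoning
      ℓe≤ℓx : ℓ e ℚ.≤ ℓ x
      ℓe≤ℓx = ℚP.≮⇒≥ λ ℓx<ℓe →
        x∉D-e (x∈p∧x≢y⇒x∈p-y (eL⊆D (q⊆p∪q ⁅ e ⁆ L (∈-select⁺ _ (x∈B₀ , ℓx<ℓe))))
                              (λ x≡e → e∉B₀ (subst (_∈ B₀) x≡e x∈B₀)))

-- Shellings

module Shelling {n N} (F R : Fin (suc N) → Subset n) (isR : ∀ k → IsRestriction F k (R k)) where

  open IntPoset R

  R⊆F : ∀ k → R k ⊆ F k
  R⊆F k = proj₁ (isR k)

  FirstFacet : Subset n → Fin (suc N) → Set
  FirstFacet G k = G ⊆ F k × (∀ i → i Fin.< k → ¬ (G ⊆ F i))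

  firstFacet⇔ : ∀ {G k} → FirstFacet G k ⇔ (R k ⊆ G × G ⊆ F k)
  firstFacet⇔ {G} {k} = mk⇔
    (λ (G⊆Fk , new) → Equivalence.to (proj₂ (isR k) G) ((k , FinP.≤-refl , G⊆Fk) , new))
    (λ (Rk⊆G , G⊆Fk) → G⊆Fk , proj₂ (Equivalence.from (proj₂ (isR k) G) (Rk⊆G , G⊆Fk)))

  firstFacet-≤ : ∀ {G k i} → FirstFacet G k → G ⊆ F i → k Fin.≤ i
  firstFacet-≤ (_ , new) G⊆Fi = ℕP.≮⇒≥ λ i<k → new _ i<k G⊆Fi

  firstFacet-unique : ∀ {G k k′} → FirstFacet G k → FirstFacet G k′ → k ≡ k′
  firstFacet-unique first first′ = FinP.≤-antisym (firstFacet-≤ first (proj₁ first′)) (firstFacet-≤ first′ (proj₁ first))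

  firstFacet : ∀ {G i} → G ⊆ F i → ∃ (FirstFacet G)
  firstFacet {G} {i} G⊆Fi = least (λ k → G ⊆? F k) (i , G⊆Fi)

  firstFacet-R : ∀ k → FirstFacet (R k) k
  firstFacet-R k = Equivalence.from firstFacet⇔ (⊆-refl , R⊆F k)

  R-injective : ∀ {k k′} → R k ≡ R k′ → k ≡ k′
  R-injective {k} {k′} Rk≡Rk′ =
    firstFacet-unique (firstFacet-R k) (Equivalence.from firstFacet⇔ (⊆-reflexive (sym Rk≡Rk′) , subst (_⊆ F k′) (sym Rk≡Rk′) (R⊆F k′)))

  R⊆⊥⇒≡zero : ∀ {k} → R k ⊆ ⊥ → k ≡ zero
  R⊆⊥⇒≡zero Rk⊆⊥ = firstFacet-unique (Equivalence.from firstFacet⇔ (Rk⊆⊥ , ⊥⊆)) (⊥⊆ , λ _ ())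

  R-zero : R zero ≡ ⊥
  R-zero = ⊆-antisym (Equivalence.to firstFacet⇔ (⊥⊆ , λ _ ()) .proj₁) ⊥⊆

  ∣R∣≡0⇒≡zero : ∀ {k} → ∣ R k ∣ ≡ 0 → k ≡ zero
  ∣R∣≡0⇒≡zero ∣Rk∣≡0 = R⊆⊥⇒≡zero (⊆-reflexive (∣p∣≡0⇒p≡⊥ ∣Rk∣≡0))

  ∣R-zero∣ : ∣ R zero ∣ ≡ 0
  ∣R-zero∣ = trans (cong ∣_∣ R-zero) (∣⊥∣≡0 n)

  firstWithout : ∀ k → Fin n → Fin (suc N)
  firstWithout k e = proj₁ (firstFacet (⊆-trans (p─q⊆p (R k) ⁅ e ⁆) (R⊆F k)))

  firstWithout-first : ∀ k e → FirstFacet (R k - e) (firstWithout k e)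
  firstWithout-first k e = proj₂ (firstFacet (⊆-trans (p─q⊆p (R k) ⁅ e ⁆) (R⊆F k)))

  -- A g ∈ R k - e outside R z would give R k ⊆ F z with z < k, as R k - g is covered no later than R k - e.
  R-firstWithout-latest : ∀ {k e} → e ∈ R k → (∀ g → g ∈ R k → firstWithout k g Fin.≤ firstWithout k e) →
                          R (firstWithout k e) ≡ R k - e
  R-firstWithout-latest {k} {e} e∈Rk latest = ⊆-antisym Rz⊆Rk-e (λ {g} → g∈Rz g)
    where
    z : Fin (suc N)
    z = firstWithout k e
    Rz⊆Rk-e : R z ⊆ R k - e
    Rz⊆Rk-e = proj₁ (Equivalence.to firstFacet⇔ (firstWithout-first k e))
    z≢k : z ≢ k
    z≢k z≡k = x∉p-x (R k) e (Rz⊆Rk-e (subst (λ i → e ∈ R i) (sym z≡k) e∈Rk))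
    g∈Rz : ∀ g → g ∈ R k - e → g ∈ R z
    g∈Rz g g∈Rk-e = decidable-stable (g ∈? R z) λ g∉Rz →
      z≢k (FinP.≤-antisym (firstFacet-≤ (firstWithout-first k e) (⊆-trans (p─q⊆p (R k) ⁅ e ⁆) (R⊆F k)))
                          (firstFacet-≤ (firstFacet-R k) (Rk⊆Fz g∉Rz)))
      where
      Rk-e-g⊆Rk-g : R k - e - g ⊆ R k - g
      Rk-e-g⊆Rk-g x∈ = x∈p∧x≢y⇒x∈p-y (p─q⊆p (R k) ⁅ e ⁆ (p─q⊆p (R k - e) ⁅ g ⁆ x∈))
                                     (x∉⁅y⁆⇒x≢y (x∈p─q⇒x∉q (R k - e) ⁅ g ⁆ x∈))
      firstWithout-g≡z : g ∉ R z → firstWithout k g ≡ z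
      firstWithout-g≡z g∉Rz = FinP.≤-antisym (latest g (p─q⊆p (R k) ⁅ e ⁆ g∈Rk-e))
        (firstFacet-≤ firstAt-z (⊆-trans Rk-e-g⊆Rk-g (proj₁ (firstWithout-first k g))))
        where
        firstAt-z : FirstFacet (R k - e - g) z
        firstAt-z = Equivalence.from firstFacet⇔
          ((λ x∈Rz → x∈p∧x≢y⇒x∈p-y (Rz⊆Rk-e x∈Rz) λ { refl → g∉Rz x∈Rz }) ,
           ⊆-trans (p─q⊆p (R k - e) ⁅ g ⁆) (proj₁ (firstWithout-first k e)))
      Rk⊆Fz : g ∉ R z → R k ⊆ F z
      Rk⊆Fz g∉Rz {x} x∈Rk with x FinP.≟ g
      ... | yes refl = proj₁ (firstWithout-first k e) g∈Rk-e
      ... | no  x≢g  = subst (λ i → R k - g ⊆ F i) (firstWithout-g≡z g∉Rz) (proj₁ (firstWithout-first k g))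
                             (x∈p∧x≢y⇒x∈p-y x∈Rk x≢g)

  lowerCover : ∀ k → Nonempty (R k) → ∃ λ z → R z ⊆ R k × suc ∣ R z ∣ ≡ ∣ R k ∣
  lowerCover k nonempty with argmaxIn (R k) (toℕ ∘ firstWithout k) nonempty
  ... | e , e∈Rk , latest =
    firstWithout k e , ⊆-trans (⊆-reflexive Rz≡Rk-e) (p─q⊆p (R k) ⁅ e ⁆) ,
    trans (cong (suc ∘ ∣_∣) Rz≡Rk-e) (x∈p⇒1+∣p-x∣≡∣p∣ e∈Rk)
    where
    Rz≡Rk-e : R (firstWithout k e) ≡ R k - e
    Rz≡Rk-e = R-firstWithout-latest e∈Rk latest

  ⪯∧≢⇒∣R∣< : ∀ {x y} → x ⪯ y → x ≢ y → ∣ R x ∣ ℕ.< ∣ R y ∣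
  ⪯∧≢⇒∣R∣< {x} {y} Rx⊆Ry x≢y = ℕP.≤∧≢⇒< (p⊆q⇒∣p∣≤∣q∣ Rx⊆Ry) (x≢y ∘ R-injective ∘ p⊆q⇒∣q∣≤∣p∣⇒p≡q Rx⊆Ry ∘ ℕP.≤-reflexive ∘ sym)

  isMin-zero : IsMin zero
  isMin-zero m = ⊆-trans (⊆-reflexive R-zero) ⊥⊆

  isMin⇒≡zero : ∀ {m} → IsMin m → m ≡ zero
  isMin⇒≡zero min = R⊆⊥⇒≡zero (⊆-trans (min zero) (⊆-reflexive R-zero))

  covers-by-size : ∀ {x y} → x ⪯ y → suc ∣ R x ∣ ≡ ∣ R y ∣ → Covers x y
  covers-by-size {x} {y} x⪯y 1+∣Rx∣≡∣Ry∣ = (x⪯y , x≢y) , λ z (x⪯z , x≢z) (z⪯y , z≢y) →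
    ℕP.<⇒≱ (⪯∧≢⇒∣R∣< x⪯z x≢z) (ℕP.≤-pred (subst (∣ R z ∣ ℕ.<_) (sym 1+∣Rx∣≡∣Ry∣) (⪯∧≢⇒∣R∣< z⪯y z≢y)))
    where
    x≢y : x ≢ y
    x≢y refl = ℕP.1+n≢n 1+∣Rx∣≡∣Ry∣

  atom⇔∣R∣≡1 : ∀ {a} → IsAtom a ⇔ ∣ R a ∣ ≡ 1
  atom⇔∣R∣≡1 {a} = mk⇔ atom⇒∣R∣≡1
    (λ ∣Ra∣≡1 → zero , isMin-zero , covers-by-size (isMin-zero a) (trans (cong suc ∣R-zero∣) (sym ∣Ra∣≡1)))
    where
    coverOfZero⇒∣R∣≡1 : Covers zero a → ∣ R a ∣ ≡ 1
    coverOfZero⇒∣R∣≡1 ((_ , zero≢a) , cover) = byLowerCover (lowerCover a (∣p∣≢0⇒nonempty (ℕP.>⇒≢ 0<∣Ra∣)))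
      where
      0<∣Ra∣ : 0 ℕ.< ∣ R a ∣
      0<∣Ra∣ = subst (ℕ._< ∣ R a ∣) ∣R-zero∣ (⪯∧≢⇒∣R∣< (isMin-zero a) zero≢a)
      byLowerCover : (∃ λ z → R z ⊆ R a × suc ∣ R z ∣ ≡ ∣ R a ∣) → ∣ R a ∣ ≡ 1
      byLowerCover (z , Rz⊆Ra , 1+∣Rz∣≡∣Ra∣) with ∣ R z ∣ ℕ.≟ 0
      ... | yes ∣Rz∣≡0 = trans (sym 1+∣Rz∣≡∣Ra∣) (cong suc ∣Rz∣≡0)
      ... | no  ∣Rz∣≢0 = ⊥-elim (cover z (isMin-zero z , ∣Rz∣≢0 ∘ zero≡z⇒∣Rz∣≡0) (Rz⊆Ra , z≢a))
        where
        zero≡z⇒∣Rz∣≡0 : zero ≡ z → ∣ R z ∣ ≡ 0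
        zero≡z⇒∣Rz∣≡0 refl = ∣R-zero∣
        z≢a : z ≢ a
        z≢a refl = ℕP.1+n≢n 1+∣Rz∣≡∣Ra∣
    atom⇒∣R∣≡1 : IsAtom a → ∣ R a ∣ ≡ 1
    atom⇒∣R∣≡1 (m , min , m⋖a) = coverOfZero⇒∣R∣≡1 (subst (λ m → Covers m a) (isMin⇒≡zero min) m⋖a)

  rank≡∣R∣ : ∀ {ρ} → IsRankFunction ρ → ∀ k → ρ k ≡ ∣ R k ∣
  rank≡∣R∣ {ρ} (ρ-min , ρ-cover) k = byLevel ∣ R k ∣ k refl
    where
    byLevel : ∀ s k → ∣ R k ∣ ≡ s → ρ k ≡ ∣ R k ∣
    byLevel zero k ∣Rk∣≡0 = subst (λ k → ρ k ≡ ∣ R k ∣) (sym (∣R∣≡0⇒≡zero ∣Rk∣≡0)) (trans (ρ-min zero isMin-zero) (sym ∣R-zero∣))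
    byLevel (suc s) k ∣Rk∣≡1+s = byLowerCover (lowerCover k (∣p∣≢0⇒nonempty (λ ∣Rk∣≡0 → ℕP.1+n≢0 (trans (sym ∣Rk∣≡1+s) ∣Rk∣≡0))))
      where
      byLowerCover : (∃ λ z → R z ⊆ R k × suc ∣ R z ∣ ≡ ∣ R k ∣) → ρ k ≡ ∣ R k ∣
      byLowerCover (z , Rz⊆Rk , 1+∣Rz∣≡∣Rk∣) = begin
        ρ k             ≡⟨ ρ-cover z k (covers-by-size Rz⊆Rk 1+∣Rz∣≡∣Rk∣) ⟩
        suc (ρ z)       ≡⟨ cong suc (byLevel s z (ℕP.suc-injective (trans 1+∣Rz∣≡∣Rk∣ ∣Rk∣≡1+s))) ⟩
        suc ∣ R z ∣     ≡⟨ 1+∣Rz∣≡∣Rk∣ ⟩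
        ∣ R k ∣         ∎
        where open ≡-Reasoning

  R≡⁅i⁆⇒i∉F₀ : ∀ {a i} → R a ≡ ⁅ i ⁆ → i ∉ F zero
  R≡⁅i⁆⇒i∉F₀ {a} {i} Ra≡⁅i⁆ i∈F₀ = ∉⊥ (subst (i ∈_) (trans (sym Ra≡⁅i⁆) (trans (cong R a≡zero) R-zero)) (x∈⁅x⁆ i))
    where
    a≡zero : a ≡ zero
    a≡zero = firstFacet-unique (Equivalence.from firstFacet⇔ (⊆-reflexive Ra≡⁅i⁆ , subst (_⊆ F a) Ra≡⁅i⁆ (R⊆F a)))
                               (x∈p⇒⁅x⁆⊆p i∈F₀ , λ _ ())

  ∃R≡⁅i⁆ : ∀ {i m} → i ∈ F m → i ∉ F zero → ∃ λ a → R a ≡ ⁅ i ⁆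
  ∃R≡⁅i⁆ {i} i∈Fm i∉F₀ with firstFacet (x∈p⇒⁅x⁆⊆p i∈Fm)
  ... | a , firstAt-a = a , p⊆q⇒∣q∣≤∣p∣⇒p≡q Ra⊆⁅i⁆ (subst (ℕ._≤ ∣ R a ∣) (sym (∣⁅x⁆∣≡1 i)) 0<∣Ra∣)
    where
    Ra⊆⁅i⁆ : R a ⊆ ⁅ i ⁆
    Ra⊆⁅i⁆ = proj₁ (Equivalence.to firstFacet⇔ firstAt-a)
    0<∣Ra∣ : 0 ℕ.< ∣ R a ∣
    0<∣Ra∣ = ℕP.n≢0⇒n>0 λ ∣Ra∣≡0 → i∉F₀ (subst (λ k → i ∈ F k) (∣R∣≡0⇒≡zero ∣Ra∣≡0) (proj₁ firstAt-a (x∈⁅x⁆ i)))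

  atomsBelow⇔ : ∀ {k m I} → (∀ {i} → i ∈ I → i ∉ F zero) → I ⊆ F m → AtomsBelowAre k I ⇔ (R k ─ F zero ≡ I)
  atomsBelow⇔ {k} {m} {I} I∩F₀≡∅ I⊆Fm = mk⇔ atomsBelow⇒ atomsBelow⇐
    where
    singletonAtom : ∀ {a i} → R a ≡ ⁅ i ⁆ → IsAtom a
    singletonAtom {i = i} Ra≡⁅i⁆ = Equivalence.from atom⇔∣R∣≡1 (trans (cong ∣_∣ Ra≡⁅i⁆) (∣⁅x⁆∣≡1 i))
    atomsBelow⇒ : AtomsBelowAre k I → R k ─ F zero ≡ I
    atomsBelow⇒ below = ⊆-antisym Rk─F₀⊆I I⊆Rk─F₀
      where
      Rk─F₀⊆I : R k ─ F zero ⊆ I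
      Rk─F₀⊆I {x} x∈Rk─F₀ with ∃R≡⁅i⁆ (R⊆F k (p─q⊆p (R k) (F zero) x∈Rk─F₀)) (x∈p─q⇒x∉q (R k) (F zero) x∈Rk─F₀)
      ... | a , Ra≡⁅x⁆ with Equivalence.to (below a)
                              (singletonAtom Ra≡⁅x⁆ , ⊆-trans (⊆-reflexive Ra≡⁅x⁆) (x∈p⇒⁅x⁆⊆p (p─q⊆p (R k) (F zero) x∈Rk─F₀)))
      ...   | i , i∈I , Ra≡⁅i⁆ = subst (_∈ I) (sym (x∈⁅y⁆⇒x≡y i (subst (x ∈_) (trans (sym Ra≡⁅x⁆) Ra≡⁅i⁆) (x∈⁅x⁆ x)))) i∈I
      I⊆Rk─F₀ : I ⊆ R k ─ F zero
      I⊆Rk─F₀ {i} i∈I with ∃R≡⁅i⁆ (I⊆Fm i∈I) (I∩F₀≡∅ i∈I)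
      ... | a , Ra≡⁅i⁆ = x∈p∧x∉q⇒x∈p─q (proj₂ (Equivalence.from (below a) (i , i∈I , Ra≡⁅i⁆)) (subst (i ∈_) (sym Ra≡⁅i⁆) (x∈⁅x⁆ i)))
                                         (I∩F₀≡∅ i∈I)
    atomsBelow⇐ : R k ─ F zero ≡ I → AtomsBelowAre k I
    atomsBelow⇐ Rk─F₀≡I a = mk⇔
      (λ (atom , a⪯k) → let (i , Ra≡⁅i⁆) = ∣p∣≡1⇒p≡⁅x⁆ (Equivalence.to atom⇔∣R∣≡1 atom) in
        i , subst (i ∈_) Rk─F₀≡I (x∈p∧x∉q⇒x∈p─q (a⪯k (subst (i ∈_) (sym Ra≡⁅i⁆) (x∈⁅x⁆ i))) (R≡⁅i⁆⇒i∉F₀ Ra≡⁅i⁆)) , Ra≡⁅i⁆)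
      (λ (i , i∈I , Ra≡⁅i⁆) → singletonAtom Ra≡⁅i⁆ ,
        ⊆-trans (⊆-reflexive Ra≡⁅i⁆) (x∈p⇒⁅x⁆⊆p (p─q⊆p (R k) (F zero) (subst (i ∈_) (sym Rk─F₀≡I) i∈I))))

module PinnedShelling {n} (M : Matroid n) {N} (S : BLShelling M N) (pinned : Pinned S)
                      (R : Fin (suc N) → Subset n) (isR : ∀ k → IsRestriction (B S) k (R k)) where

  open Shelling (B S) R isR

  private
    F₀ : Subset n
    F₀ = B S zero
    bF₀ : IsBasis M F₀
    bF₀ = B-basis S zero

  F₀-lightest : ∀ k D → IsBasis M D → D ≢ F₀ → weight (wit S k) F₀ ℚ.< weight (wit S k) D
  F₀-lightest k D bD D≢F₀ with B-surj S D bD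
  ... | m , Fm≡D = subst (λ D → weight (wit S k) F₀ ℚ.< weight (wit S k) D) Fm≡D
                     (pinned k m λ { refl → D≢F₀ (sym Fm≡D) })

  lighter : Fin (suc N) → Fin n → Subset n
  lighter k = lighterThan M (wit S k) bF₀ (F₀-lightest k)

  exchangeLighter : ∀ {k e} → e ∈ B S k → e ∉ F₀ →
                    ∃ λ y → (y ∈ lighter k e × y ∉ B S k - e) × Indep M (⁅ y ⁆ ∪ (B S k - e))
  exchangeLighter {k} {e} e∈Fk e∉F₀
    with FinP.any? (λ y → (y ∈? lighter k e ×-dec ¬? (y ∈? B S k - e)) ×-dec indep? M (⁅ y ⁆ ∪ (B S k - e)))
  ... | yes found = found
  ... | no  none  = ⊥-elim (lighter-insert-dependent M (wit S k) bF₀ (F₀-lightest k) e∉F₀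
    (spanned⇒insert-indep M (x∉p-x (B S k) e) (subst (Indep M) (sym (x∈p⇒⁅x⁆∪[p-x]≡p e∈Fk)) (proj₁ (B-basis S k)))
      (indep-⊆ M (proj₁ ∘ ∈-select⁻ _) (proj₁ bF₀))
      λ y y∈L y∉Fk-e iyFk-e → none (y , (y∈L , y∉Fk-e) , iyFk-e)))

  exchange-isBasis : ∀ {k e y} → e ∈ B S k → y ∉ B S k - e → Indep M (⁅ y ⁆ ∪ (B S k - e)) → IsBasis M (⁅ y ⁆ ∪ (B S k - e))
  exchange-isBasis {k} {e} {y} e∈Fk y∉Fk-e iyFk-e = indep∧∣∣≡⇒basis M bF₀ iyFk-e (begin
    ∣ ⁅ y ⁆ ∪ (B S k - e) ∣   ≡⟨ x∉p⇒∣⁅x⁆∪p∣≡1+∣p∣ y∉Fk-e ⟩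
    suc ∣ B S k - e ∣         ≡⟨ x∈p⇒1+∣p-x∣≡∣p∣ e∈Fk ⟩
    ∣ B S k ∣                 ≡⟨ basis-∣∣-unique M (B-basis S k) bF₀ ⟩
    ∣ F₀ ∣                    ∎)
    where open ≡-Reasoning

  exchange-earlier : ∀ {k e y m} → e ∈ B S k → y ∈ lighter k e → y ∉ B S k - e → B S m ≡ ⁅ y ⁆ ∪ (B S k - e) → m Fin.< k
  exchange-earlier {k} {e} {y} {m} e∈Fk y∈L y∉Fk-e Fm≡yFk-e = Equivalence.to (wit-ok S k m) (begin-strict
    weight ℓ (B S m)                 ≡⟨ cong (weight ℓ) Fm≡yFk-e ⟩
    weight ℓ (⁅ y ⁆ ∪ (B S k - e))   ≡⟨ weight-insert ℓ y∉Fk-e ⟩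
    ℓ y ℚ.+ weight ℓ (B S k - e)     <⟨ ℚP.+-monoˡ-< (weight ℓ (B S k - e)) (proj₂ (∈-select⁻ _ y∈L)) ⟩
    ℓ e ℚ.+ weight ℓ (B S k - e)     ≡⟨ weight-remove ℓ e∈Fk ⟨
    weight ℓ (B S k)                 ∎)
    where
    open ℚP.≤-Reasoning
    ℓ : Fin n → ℚ
    ℓ = wit S k

  -- If e ∉ R k, the exchanged basis is a facet before B S k containing B S k - e,
  -- although R k ⊆ B S k - e says that this face is new at k.
  F─F₀⊆R : ∀ k → B S k ─ F₀ ⊆ R k
  F─F₀⊆R k {e} e∈Fk─F₀ = decidable-stable (e ∈? R k) λ e∉Rk →
    let (y , (y∈L , y∉Fk-e) , iyFk-e) = exchangeLighter e∈Fk e∉F₀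
        (m , Fm≡yFk-e) = B-surj S _ (exchange-isBasis e∈Fk y∉Fk-e iyFk-e) in
    proj₂ (Equivalence.from firstFacet⇔ (Rk⊆Fk-e e∉Rk , p─q⊆p (B S k) ⁅ e ⁆)) m (exchange-earlier e∈Fk y∈L y∉Fk-e Fm≡yFk-e)
          (⊆-trans (q⊆p∪q ⁅ y ⁆ (B S k - e)) (⊆-reflexive (sym Fm≡yFk-e)))
    where
    e∈Fk : e ∈ B S k
    e∈Fk = p─q⊆p (B S k) F₀ e∈Fk─F₀
    e∉F₀ : e ∉ F₀
    e∉F₀ = x∈p─q⇒x∉q (B S k) F₀ e∈Fk─F₀
    Rk⊆Fk-e : e ∉ R k → R k ⊆ B S k - e
    Rk⊆Fk-e e∉Rk {x} x∈Rk = x∈p∧x≢y⇒x∈p-y (R⊆F k x∈Rk) λ { refl → e∉Rk x∈Rk }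

-- Counting bases by their atoms

module CountByAtoms {n} (M : Matroid n) {N} (S : BLShelling M N) (pinned : Pinned S)
                (R : Fin (suc N) → Subset n) (isR : ∀ k → IsRestriction (B S) k (R k))
                (I : Subset n) (iI : Indep M I) (I∩F₀≡⊥ : I ∩ B S zero ≡ ⊥) where

  open Shelling (B S) R isR
  open PinnedShelling M S pinned R isR using (F─F₀⊆R)
  open IntPoset R using (AtomsBelowAre)

  private
    F : Fin (suc N) → Subset n
    F = B S
    F₀ : Subset n
    F₀ = B S zero

  I∉F₀ : ∀ {i} → i ∈ I → i ∉ F₀
  I∉F₀ i∈I i∈F₀ = ∉⊥ (subst (_ ∈_) I∩F₀≡⊥ (x∈p∩q⁺ (i∈I , i∈F₀)))

  facetContaining : ∀ {X} → Indep M X → ∃ λ m → X ⊆ F m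
  facetContaining iX with extendToBasis M iX
  ... | A , bA , X⊆A with B-surj S A bA
  ...   | m , Fm≡A = m , ⊆-trans X⊆A (⊆-reflexive (sym Fm≡A))

  R─F₀≡F─F₀ : ∀ k → R k ─ F₀ ≡ F k ─ F₀
  R─F₀≡F─F₀ k = ⊆-antisym
    (λ x∈ → x∈p∧x∉q⇒x∈p─q (R⊆F k (p─q⊆p (R k) F₀ x∈)) (x∈p─q⇒x∉q (R k) F₀ x∈))
    (λ x∈ → x∈p∧x∉q⇒x∈p─q (F─F₀⊆R k x∈) (x∈p─q⇒x∉q (F k) F₀ x∈))

  atomsBelow⇔F─F₀≡I : ∀ k → AtomsBelowAre k I ⇔ (F k ─ F₀ ≡ I)
  atomsBelow⇔F─F₀≡I k =
    ⇔-trans (atomsBelow⇔ I∉F₀ (proj₂ (facetContaining iI)))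
      (mk⇔ (trans (sym (R─F₀≡F─F₀ k))) (trans (R─F₀≡F─F₀ k)))

  ∣R∣≡∣I∣+∣R∩F₀∣ : ∀ {k} → F k ─ F₀ ≡ I → ∣ R k ∣ ≡ ∣ I ∣ + ∣ R k ∩ F₀ ∣
  ∣R∣≡∣I∣+∣R∩F₀∣ {k} Fk─F₀≡I = begin
    ∣ R k ∣                      ≡⟨ ∣p∣≡∣p∩q∣+∣p─q∣ (R k) F₀ ⟩
    ∣ R k ∩ F₀ ∣ + ∣ R k ─ F₀ ∣   ≡⟨ cong (λ X → ∣ R k ∩ F₀ ∣ + ∣ X ∣) (trans (R─F₀≡F─F₀ k) Fk─F₀≡I) ⟩
    ∣ R k ∩ F₀ ∣ + ∣ I ∣          ≡⟨ ℕP.+-comm _ ∣ I ∣ ⟩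
    ∣ I ∣ + ∣ R k ∩ F₀ ∣          ∎
    where open ≡-Reasoning

  c : ℕ
  c = ∣ F₀ ∣ ∸ ∣ I ∣

  ∣F∩F₀∣≡c : ∀ {k} → F k ─ F₀ ≡ I → ∣ F k ∩ F₀ ∣ ≡ c
  ∣F∩F₀∣≡c {k} Fk─F₀≡I = begin
    ∣ F k ∩ F₀ ∣                          ≡⟨ ℕP.m+n∸n≡m _ ∣ I ∣ ⟨
    ∣ F k ∩ F₀ ∣ + ∣ I ∣ ∸ ∣ I ∣           ≡⟨ cong (λ X → ∣ F k ∩ F₀ ∣ + ∣ X ∣ ∸ ∣ I ∣) Fk─F₀≡I ⟨
    ∣ F k ∩ F₀ ∣ + ∣ F k ─ F₀ ∣ ∸ ∣ I ∣    ≡⟨ cong (_∸ ∣ I ∣) (∣p∣≡∣p∩q∣+∣p─q∣ (F k) F₀) ⟨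
    ∣ F k ∣ ∸ ∣ I ∣                        ≡⟨ cong (_∸ ∣ I ∣) (basis-∣∣-unique M (B-basis S k) (B-basis S zero)) ⟩
    c                                      ∎
    where open ≡-Reasoning

  -- The faces J of (M/I)|F₀ whose face J ∪ I first appears in the facet F k.
  FaceAt : Fin (suc N) → ℕ → Subset n → Set
  FaceAt k i J = (R k ⊆ J ∪ I × J ∪ I ⊆ F k) × J ⊆ F₀ × ∣ J ∣ ≡ i

  faceAt? : ∀ k i → Decidable (FaceAt k i)
  faceAt? k i J = (R k ⊆? J ∪ I ×-dec J ∪ I ⊆? F k) ×-dec J ⊆? F₀ ×-dec ∣ J ∣ ℕ.≟ i

  faceAt⇒F─F₀≡I : ∀ {k i J} → FaceAt k i J → F k ─ F₀ ≡ I
  faceAt⇒F─F₀≡I {k} {i} {J} ((Rk⊆J∪I , J∪I⊆Fk) , J⊆F₀ , _) = ⊆-antisym Fk─F₀⊆I I⊆Fk─F₀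
    where
    Fk─F₀⊆I : F k ─ F₀ ⊆ I
    Fk─F₀⊆I x∈ with x∈p∪q⁻ J I (Rk⊆J∪I (F─F₀⊆R k x∈))
    ... | inj₁ x∈J = ⊥-elim (x∈p─q⇒x∉q (F k) F₀ x∈ (J⊆F₀ x∈J))
    ... | inj₂ x∈I = x∈I
    I⊆Fk─F₀ : I ⊆ F k ─ F₀
    I⊆Fk─F₀ x∈I = x∈p∧x∉q⇒x∈p─q (J∪I⊆Fk (q⊆p∪q J I x∈I)) (I∉F₀ x∈I)

  faceAt⇔intervalLayer : ∀ {k i J} → F k ─ F₀ ≡ I → FaceAt k i J ⇔ IntervalLayer (R k ∩ F₀) (F k ∩ F₀) i J
  faceAt⇔intervalLayer {k} {i} {J} Fk─F₀≡I = mk⇔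
    (λ ((Rk⊆J∪I , J∪I⊆Fk) , J⊆F₀ , ∣J∣≡i) →
      (λ x∈ → let (x∈Rk , x∈F₀) = x∈p∩q⁻ (R k) F₀ x∈ in
              case x∈p∪q⁻ J I (Rk⊆J∪I x∈Rk) of λ { (inj₁ x∈J) → x∈J ; (inj₂ x∈I) → ⊥-elim (I∉F₀ x∈I x∈F₀) }) ,
      (λ x∈J → x∈p∩q⁺ (J∪I⊆Fk (p⊆p∪q I x∈J) , J⊆F₀ x∈J)) ,
      ∣J∣≡i)
    (λ (A⊆J , J⊆D , ∣J∣≡i) →
      (Rk⊆J∪I A⊆J , ∪-lub (⊆-trans J⊆D (p∩q⊆p (F k) F₀)) I⊆Fk) , ⊆-trans J⊆D (p∩q⊆q (F k) F₀) , ∣J∣≡i)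
    where
    I⊆Fk : I ⊆ F k
    I⊆Fk = ⊆-trans (⊆-reflexive (sym Fk─F₀≡I)) (p─q⊆p (F k) F₀)
    Rk⊆J∪I : R k ∩ F₀ ⊆ J → R k ⊆ J ∪ I
    Rk⊆J∪I A⊆J {x} x∈Rk with x ∈? F₀
    ... | yes x∈F₀ = p⊆p∪q I (A⊆J (x∈p∩q⁺ (x∈Rk , x∈F₀)))
    ... | no  x∉F₀ = q⊆p∪q J I (subst (x ∈_) Fk─F₀≡I (x∈p∧x∉q⇒x∈p─q (R⊆F k x∈Rk) x∉F₀))

  Face : Subset n → Set
  Face J = J ⊆ F₀ × Indep M (J ∪ I)

  faceAt-exists : ∀ {J i} → Face J × ∣ J ∣ ≡ i → ∃ λ k → FaceAt k i J
  faceAt-exists ((J⊆F₀ , iJI) , ∣J∣≡i) =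
    let (m , JI⊆Fm) = facetContaining iJI
        (k , first) = firstFacet JI⊆Fm in
    k , Equivalence.to firstFacet⇔ first , J⊆F₀ , ∣J∣≡i

  faceAt⇒face : ∀ {k i J} → FaceAt k i J → Face J × ∣ J ∣ ≡ i
  faceAt⇒face {k} ((_ , JI⊆Fk) , J⊆F₀ , ∣J∣≡i) = (J⊆F₀ , indep-⊆ M JI⊆Fk (proj₁ (B-basis S k))) , ∣J∣≡i

  faceAt-unique : ∀ {k k′ i J} → FaceAt k i J → FaceAt k′ i J → k ≡ k′
  faceAt-unique (at , _) (at′ , _) = firstFacet-unique (Equivalence.from firstFacet⇔ at) (Equivalence.from firstFacet⇔ at′)

  fSize≡∑faceAt : ∀ i → + fSize M I F₀ i ≡ ∑[ k < suc N ] (+ count (faceAt? k i) (allSubsets n))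
  fSize≡∑faceAt i = trans (cong +_ (count-filter _ (λ J → ∣ J ∣ ℕ.≟ i) (allSubsets n)))
                          (count-partition _ (λ k → faceAt? k i) faceAt-exists faceAt⇒face faceAt-unique (allSubsets n))

  R∩F₀⊆F∩F₀ : ∀ k → R k ∩ F₀ ⊆ F k ∩ F₀
  R∩F₀⊆F∩F₀ k x∈ = let (x∈Rk , x∈F₀) = x∈p∩q⁻ (R k) F₀ x∈ in x∈p∩q⁺ (R⊆F k x∈Rk , x∈F₀)

  -- The largest faces are the sets F k ∩ F₀ with F k ─ F₀ ≡ I; the first facet containing I is such an F k.
  dimPlus1≡c : dimPlus1 M I F₀ ≡ c
  dimPlus1≡c with faceAt-exists {⊥} {0} ((⊥⊆ , subst (Indep M) (sym (∪-identityˡ I)) iI) , ∣⊥∣≡0 n)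
  ... | k , at = ℕP.≤-antisym
    (foldr-⊔-≤ ∣_∣ (faces M I F₀) λ J J∈faces → faceSize (proj₂ (∈-filter⁻ _ {xs = allSubsets n} J∈faces)))
    (subst (ℕ._≤ dimPlus1 M I F₀) (∣F∩F₀∣≡c Fk─F₀≡I)
      (≤-foldr-⊔ ∣_∣ (∈-filter⁺ _ (∈-allSubsets (F k ∩ F₀)) (proj₁ (faceAt⇒face largest)))))
    where
    Fk─F₀≡I : F k ─ F₀ ≡ I
    Fk─F₀≡I = faceAt⇒F─F₀≡I at
    largest : FaceAt k ∣ F k ∩ F₀ ∣ (F k ∩ F₀)
    largest = Equivalence.from (faceAt⇔intervalLayer Fk─F₀≡I) (R∩F₀⊆F∩F₀ k , ⊆-refl , refl)
    faceSize : ∀ {J} → Face J → ∣ J ∣ ℕ.≤ c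
    faceSize {J} (J⊆F₀ , iJI) = ℕP.m+n≤o⇒m≤o∸n ∣ J ∣ (begin
      ∣ J ∣ + ∣ I ∣   ≡⟨ ∣p∪q∣≡∣p∣+∣q∣ J I (λ (x , x∈J∩I) → let (x∈J , x∈I) = x∈p∩q⁻ J I x∈J∩I in I∉F₀ x∈I (J⊆F₀ x∈J)) ⟨
      ∣ J ∪ I ∣       ≤⟨ basis⇒∣∣≤ M (B-basis S zero) iJI ⟩
      ∣ F₀ ∣          ∎)
      where open ℕP.≤-Reasoning

  Target : ℕ → Fin (suc N) → Set
  Target j k = (∣ R k ∣ ≡ ∣ I ∣ + j) × (F k ─ F₀ ≡ I)

  target? : ∀ j → Decidable (Target j)
  target? j k = (∣ R k ∣ ℕ.≟ ∣ I ∣ + j) ×-dec (F k ─ F₀ ≟ₛ I)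

  hCoefficient : ℕ → ℕ → ℤ
  hCoefficient j i = -1ℤ ℤ.^ (j ∸ i) ℤ.* + ((c ∸ i) C (j ∸ i))

  hFibre : ℕ → Fin (suc N) → ℤ
  hFibre j k = ∑[ i < suc j ] (hCoefficient j (toℕ i) ℤ.* + count (faceAt? k (toℕ i)) (allSubsets n))

  hFibre-empty : ∀ j {k} → F k ─ F₀ ≢ I → hFibre j k ≡ + 0
  hFibre-empty j {k} Fk─F₀≢I = begin
    hFibre j k          ≡⟨ sum-cong-≗ {suc j} (λ i → trans (cong (λ m → hCoefficient j (toℕ i) ℤ.* + m) (noFaces (toℕ i)))
                                                            (ℤP.*-zeroʳ (hCoefficient j (toℕ i)))) ⟩
    ∑[ i < suc j ] (+ 0) ≡⟨ sum-replicate-zero (suc j) ⟩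
    + 0                 ∎
    where
    open ≡-Reasoning
    noFaces : ∀ i → count (faceAt? k i) (allSubsets n) ≡ 0
    noFaces i = count-none (faceAt? k i) (λ _ → Fk─F₀≢I ∘ faceAt⇒F─F₀≡I) (allSubsets n)

  hFibre-interval : ∀ j {k} → F k ─ F₀ ≡ I → hFibre j k ≡ + 𝟙 (∣ R k ∩ F₀ ∣ ℕ.≟ j)
  hFibre-interval j {k} Fk─F₀≡I = begin
    hFibre j k
      ≡⟨ sum-cong-≗ {suc j} (λ i → cong (λ m → hCoefficient j (toℕ i) ℤ.* + m) (layerCount (toℕ i))) ⟩
    ∑[ i < suc j ] (-1ℤ ℤ.^ (j ∸ toℕ i) ℤ.* + ((c ∸ toℕ i) C (j ∸ toℕ i)) ℤ.* + intervalCount ∣ A ∣ ∣ D ─ A ∣ (toℕ i))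
      ≡⟨ cong (λ d → ∑[ i < suc j ] (-1ℤ ℤ.^ (j ∸ toℕ i) ℤ.* + ((d ∸ toℕ i) C (j ∸ toℕ i)) ℤ.* + intervalCount ∣ A ∣ ∣ D ─ A ∣ (toℕ i)))
              c≡∣A∣+∣D─A∣ ⟩
    ∑[ i < suc j ] (-1ℤ ℤ.^ (j ∸ toℕ i) ℤ.* + ((∣ A ∣ + ∣ D ─ A ∣ ∸ toℕ i) C (j ∸ toℕ i)) ℤ.* + intervalCount ∣ A ∣ ∣ D ─ A ∣ (toℕ i))
      ≡⟨ ∑-alternating-intervalCount j ∣ A ∣ ∣ D ─ A ∣ ⟩
    + 𝟙 (∣ A ∣ ℕ.≟ j) ∎
    where
    open ≡-Reasoning
    A D : Subset n
    A = R k ∩ F₀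
    D = F k ∩ F₀
    c≡∣A∣+∣D─A∣ : c ≡ ∣ A ∣ + ∣ D ─ A ∣
    c≡∣A∣+∣D─A∣ = trans (sym (∣F∩F₀∣≡c Fk─F₀≡I)) (p⊆q⇒∣q∣≡∣p∣+∣q─p∣ (R∩F₀⊆F∩F₀ k))
    layerCount : ∀ i → count (faceAt? k i) (allSubsets n) ≡ intervalCount ∣ A ∣ ∣ D ─ A ∣ i
    layerCount i = trans (count-≐ (faceAt? k i) (intervalLayer? A D i)
                                  (Equivalence.to (faceAt⇔intervalLayer Fk─F₀≡I) , Equivalence.from (faceAt⇔intervalLayer Fk─F₀≡I))
                                  (allSubsets n))
                         (count-intervalLayer (R∩F₀⊆F∩F₀ k) i)

  hFibre≡𝟙target : ∀ j k → hFibre j k ≡ + 𝟙 (target? j k)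
  hFibre≡𝟙target j k = byDifference (F k ─ F₀ ≟ₛ I)
    where
    byDifference : Dec (F k ─ F₀ ≡ I) → hFibre j k ≡ + 𝟙 (target? j k)
    byDifference (no  Fk─F₀≢I) = trans (hFibre-empty j Fk─F₀≢I) (cong +_ (sym (𝟙-no (Fk─F₀≢I ∘ proj₂) (target? j k))))
    byDifference (yes Fk─F₀≡I) = trans (hFibre-interval j Fk─F₀≡I) (cong +_ (𝟙-cong
      (λ ∣A∣≡j → trans (∣R∣≡∣I∣+∣R∩F₀∣ Fk─F₀≡I) (cong (λ s → ∣ I ∣ + s) ∣A∣≡j) , Fk─F₀≡I)
      (λ (∣Rk∣≡∣I∣+j , _) → ℕP.+-cancelˡ-≡ ∣ I ∣ ∣ R k ∩ F₀ ∣ j (trans (sym (∣R∣≡∣I∣+∣R∩F₀∣ Fk─F₀≡I)) ∣Rk∣≡∣I∣+j))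
      (∣ R k ∩ F₀ ∣ ℕ.≟ j) (target? j k)))

  hVec≡count : ∀ j → hVec M I F₀ j ≡ + count (target? j) (allFin (suc N))
  hVec≡count j = begin
    hVec M I F₀ j
      ≡⟨ foldr-+-map-applyUpTo (λ i → -1ℤ ℤ.^ (j ∸ i) ℤ.* + ((dimPlus1 M I F₀ ∸ i) C (j ∸ i)) ℤ.* + fSize M I F₀ i) id (suc j) ⟩
    ∑[ i < suc j ] (-1ℤ ℤ.^ (j ∸ toℕ i) ℤ.* + ((dimPlus1 M I F₀ ∸ toℕ i) C (j ∸ toℕ i)) ℤ.* + fSize M I F₀ (toℕ i))
      ≡⟨ sum-cong-≗ {suc j} (λ i → cong₂ (λ d f → -1ℤ ℤ.^ (j ∸ toℕ i) ℤ.* + ((d ∸ toℕ i) C (j ∸ toℕ i)) ℤ.* f)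
                                          dimPlus1≡c (fSize≡∑faceAt (toℕ i))) ⟩
    ∑[ i < suc j ] (hCoefficient j (toℕ i) ℤ.* ∑[ k < suc N ] (+ count (faceAt? k (toℕ i)) (allSubsets n)))
      ≡⟨ sum-cong-≗ {suc j} (λ i → *-distribˡ-sum {suc N} (hCoefficient j (toℕ i)) (λ k → + count (faceAt? k (toℕ i)) (allSubsets n))) ⟩
    ∑[ i < suc j ] (∑[ k < suc N ] (hCoefficient j (toℕ i) ℤ.* + count (faceAt? k (toℕ i)) (allSubsets n)))
      ≡⟨ ∑-comm {suc j} {suc N} (λ i k → hCoefficient j (toℕ i) ℤ.* + count (faceAt? k (toℕ i)) (allSubsets n)) ⟩
    ∑[ k < suc N ] hFibre j k
      ≡⟨ sum-cong-≗ {suc N} (hFibre≡𝟙target j) ⟩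
    ∑[ k < suc N ] (+ 𝟙 (target? j k))
      ≡⟨ count-tabulate {m = suc N} (target? j) id ⟨
    + count (target? j) (allFin (suc N)) ∎
    where open ≡-Reasoning

  count-target : ∀ j → HasCount (Target j) (hVec M I F₀ j)
  count-target j =
    filter (target? j) (allFin (suc N)) , filter⁺ (target? j) (allFin⁺ (suc N)) ,
    (λ k → mk⇔ (proj₂ ∘ ∈-filter⁻ (target? j)) (∈-filter⁺ (target? j) (∈-allFin k))) , sym (hVec≡count j)

lemma7p2 : ∀ {n} (M : Matroid n) {N : ℕ} (S : BLShelling M N) → Pinned S →
    (R : Fin (suc N) → Subset n) → (∀ k → IsRestriction (B S) k (R k)) →
    (I : Subset n) → Indep M I → I ∩ B S zero ≡ ⊥ → (j : ℕ) →
    HasCount (λ k → (∣ R k ∣ ≡ ∣ I ∣ + j) × IntPoset.AtomsBelowAre R k I)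
    (hVec M I (B S zero) j)
    × (∀ (ρ : Fin (suc N) → ℕ) → IntPoset.IsRankFunction R ρ →
    HasCount (λ k → (ρ k ≡ ∣ I ∣ + j) × IntPoset.AtomsBelowAre R k I)
    (hVec M I (B S zero) j))
lemma7p2 M S pinned R isR I iI I∩F₀≡⊥ j =
  HasCount-≐ (λ k → ⇔-refl ×-⇔ ⇔-sym (atomsBelow⇔F─F₀≡I k)) (count-target j) ,
  λ ρ isRank → HasCount-≐ (λ k → rankForm isRank k ×-⇔ ⇔-sym (atomsBelow⇔F─F₀≡I k)) (count-target j)
  where
  open CountByAtoms M S pinned R isR I iI I∩F₀≡⊥
  open Shelling (B S) R isR using (rank≡∣R∣)
  rankForm : ∀ {ρ} → IntPoset.IsRankFunction R ρ → ∀ k → (∣ R k ∣ ≡ ∣ I ∣ + j) ⇔ (ρ k ≡ ∣ I ∣ + j)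
  rankForm isRank k = mk⇔ (trans (rank≡∣R∣ isRank k)) (trans (sym (rank≡∣R∣ isRank k)))
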